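{- Let $0<\alpha<1/2$, $0<\rho<1$, $2\le r(n)\le(1-\rho)n$, and let $\boldsymbol{d}\in\mathcal{F}_{(\alpha,r)}$, where $\mathcal{F}_{(\alpha,r)}$ is the class of $(\alpha,r)$-near-regular degree sequences of length at least $n_1$, with $n_1\in\mathbb{N}$ sufficiently large (depending on $\alpha,\rho$). Let $G\in\mathcal{G}(\boldsymbol{d})$. (i) If $\{u,v\}\in E(G)$ (respectively $\{u,v\}\notin E(G)$), then there exists $G'\in\mathcal{G}(\boldsymbol{d})$ with $\{u,v\}\notin E(G')$ (respectively $\{u,v\}\in E(G')$) and $|E(G)\triangle E(G')|\le 12$. (ii) If $\{u,w\},\{u,v\}\in E(G)$, then there exists $G'\in\mathcal{G}(\boldsymbol{d})$ with $\{u,w\}\in E(G')$, $\{u,v\}\notin E(G')$ and $|E(G)\triangle E(G')|\le 12$.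
   Context: A degree sequence $\boldsymbol{d}=(d_1,\dots,d_n)$ is $(\alpha,r)$-near-regular if $\max_i|d_i-r|\le r^\alpha$, where $r=r(n)$. $\mathcal{G}(\boldsymbol{d})$ denotes the set of simple labelled graphs on node set $[n]$ with degree sequence $\boldsymbol{d}$. $\triangle$ denotes symmetric difference. -}

module Defs where

open import Data.Nat.Base using (ℕ; _+_; _*_; _^_; _≤_; _<ᵇ_; ∣_-_∣)
open import Data.Bool.Base using (Bool; true; false; if_then_else_; _∧_; _xor_)
open import Data.Fin.Base using (Fin; toℕ)
open import Data.List.Base using (map; allFin)
open import Data.Nat.ListAction using (sum)
open import Data.Vec.Base using (Vec; lookup)
open import Relation.Binary.PropositionalEquality using (_≡_)

record Graph (n : ℕ) : Set where
  field
    adj    : Fin n → Fin n → Bool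
    sym    : ∀ u v → adj u v ≡ adj v u
    irrefl : ∀ u → adj u u ≡ false
open Graph public

Edge : ∀ {n} → Graph n → Fin n → Fin n → Set
Edge G u v = adj G u v ≡ true

NonEdge : ∀ {n} → Graph n → Fin n → Fin n → Set
NonEdge G u v = adj G u v ≡ false

b2n : Bool → ℕ
b2n true  = 1
b2n false = 0

deg : ∀ {n} → Graph n → Fin n → ℕ
deg {n} G u = sum (map (λ v → b2n (adj G u v)) (allFin n))

HasDegSeq : ∀ {n} → Graph n → Vec ℕ n → Set
HasDegSeq G d = ∀ i → deg G i ≡ lookup d i

symDiffSize : ∀ {n} → Graph n → Graph n → ℕ
symDiffSize {n} G G' =
  sum (map (λ u → sum (map (λ v →
         b2n ((toℕ u <ᵇ toℕ v) ∧ (adj G u v xor adj G' u v)))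
       (allFin n))) (allFin n))

-- (α,r)-near-regular with α = p/q (q > 0):  max_i |d_i − r| ≤ r^(p/q),
-- stated exactly (without roots) as  |d_i − r|^q ≤ r^p  for all i.
NearRegular : (p q r : ℕ) → ∀ {n} → Vec ℕ n → Set
NearRegular p q r {n} d = ∀ (i : Fin n) → ∣ lookup d i - r ∣ ^ q ≤ r ^ p

-- Deleting or inserting a pair uv while keeping every degree amounts to toggling the pairs of an
-- alternating closed walk through uv of length 4 or 6, which changes at most 12 pairs.
-- Near-regularity puts every degree within s = ⌊√r⌋ of r.  If r < 11 b (s + 1), then r is bounded,
-- and for large n double counting finds an alternating 4-cycle through every edge and an
-- alternating 6-cycle through every non-edge.  Otherwise the degree window [r − s, r + s] is narrow
-- compared with both r and n − r, and double counting the paths v ≁ z ∼ b shows that every edge lies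
-- on an alternating 4- or 6-cycle; the complement of G has a window of the same width, so the same
-- argument in the complement handles non-edges.
module Submission where

open import Defs renaming (sym to adj-sym; irrefl to adj-irrefl)

open import Data.Nat.Base
  using (ℕ; zero; suc; _+_; _*_; _∸_; _^_; _≤_; _<_; _<ᵇ_; z≤n; s≤s; NonZero; ≢-nonZero; >-nonZero; ∣_-_∣)
open import Data.Nat.Properties hiding (_≟_)
open import Data.Nat.Tactic.RingSolver using (solve-∀)
import Data.Nat.ListAction as ListAction
open import Data.Bool.Base using (Bool; true; false; not; _∧_; _∨_; _xor_)
open import Data.Bool.Properties
  using (∨-comm; ∧-comm; ∧-zeroʳ; xor-identityʳ; xor-comm; xor-same; ¬-not; not-involutive)
  renaming (_≟_ to _≟ᴮ_)
open import Data.Fin.Base using (Fin; zero; suc; toℕ; punchIn)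
open import Data.Fin.Properties using (_≟_; punchInᵢ≢i; any?)
open import Data.Vec.Base using (Vec; lookup)
open import Data.List.Base using (map; tabulate; allFin)
open import Data.List.Properties using (map-tabulate)
open import Data.Product using (Σ; ∃; ∃₂; _×_; _,_; proj₁; proj₂)
open import Data.Sum as Sum using (_⊎_; inj₁; inj₂)
open import Data.Empty using (⊥; ⊥-elim)
open import Function.Base using (_∘_; id)
open import Function.Bundles using (mk⇔)
open import Relation.Binary.PropositionalEquality
open import Relation.Nullary using (¬_; Dec; does; yes; no)
open import Relation.Nullary.Decidable using (dec-true; dec-false; does-⇔; _×-dec_; ¬?)
open import Relation.Nullary.Negation using (contradiction)
open import Algebra.Properties.CommutativeSemigroup +-commutativeSemigroup using (xy∙z≈xz∙y)
open import Algebra.Properties.Semiring.Sum +-*-semiring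
  using (sum; sum-syntax; sum-cong-≗; sum-remove; ∑-distrib-+; ∑-comm; *-distribˡ-sum; *-distribʳ-sum; sum-replicate-zero)

-- Finite sums and counting

sum-tabulate : ∀ {n} (f : Fin n → ℕ) → ListAction.sum (tabulate f) ≡ sum f
sum-tabulate {zero}  f = refl
sum-tabulate {suc n} f = cong (f zero +_) (sum-tabulate (f ∘ suc))

sum-allFin : ∀ {n} (f : Fin n → ℕ) → ListAction.sum (map f (allFin n)) ≡ sum f
sum-allFin f = trans (cong ListAction.sum (map-tabulate id f)) (sum-tabulate f)

sum-mono-≤ : ∀ {n} {f g : Fin n → ℕ} → (∀ i → f i ≤ g i) → sum f ≤ sum g
sum-mono-≤ {zero}  f≤g = z≤n
sum-mono-≤ {suc n} f≤g = +-mono-≤ (f≤g zero) (sum-mono-≤ (f≤g ∘ suc))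

sum-const : ∀ n c → ∑[ _ < n ] c ≡ n * c
sum-const zero    c = refl
sum-const (suc n) c = cong (c +_) (sum-const n c)

sum-update : ∀ {n} (f g : Fin n → ℕ) i → (∀ j → j ≢ i → f j ≡ g j) →
             sum f + g i ≡ sum g + f i
sum-update {suc n} f g i f≗g = begin
  sum f + g i                          ≡⟨ cong (_+ g i) (sum-remove {i = i} f) ⟩
  f i + sum (f ∘ punchIn i) + g i      ≡⟨ cong (λ t → f i + t + g i) (sum-cong-≗ (λ j → f≗g _ (punchInᵢ≢i i j))) ⟩
  f i + sum (g ∘ punchIn i) + g i      ≡⟨ +-comm (f i + _) (g i) ⟩
  g i + (f i + sum (g ∘ punchIn i))    ≡⟨ cong (g i +_) (+-comm (f i) _) ⟩
  g i + (sum (g ∘ punchIn i) + f i)    ≡⟨ +-assoc (g i) _ (f i) ⟨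
  g i + sum (g ∘ punchIn i) + f i      ≡⟨ cong (_+ f i) (sum-remove {i = i} g) ⟨
  sum g + f i                          ∎
  where open ≡-Reasoning

b2n≤1 : ∀ b → b2n b ≤ 1
b2n≤1 true  = ≤-refl
b2n≤1 false = z≤n

b2n-∧ : ∀ a b → b2n (a ∧ b) ≡ b2n a * b2n b
b2n-∧ true  b = sym (+-identityʳ (b2n b))
b2n-∧ false b = refl

b2n-∧-≤ˡ : ∀ a b → b2n (a ∧ b) ≤ b2n a
b2n-∧-≤ˡ true  b = b2n≤1 b
b2n-∧-≤ˡ false b = z≤n

b2n-∨ : ∀ a b → b2n (a ∨ b) ≤ b2n a + b2n b
b2n-∨ true  b = s≤s z≤n
b2n-∨ false b = ≤-refl

∧-≡true : ∀ {a b} → a ∧ b ≡ true → a ≡ true × b ≡ true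
∧-≡true {true} {true} _ = refl , refl

∨-≡false : ∀ {a b} → a ∨ b ≡ false → a ≡ false × b ≡ false
∨-≡false {false} {false} _ = refl , refl

count : ∀ {n} → (Fin n → Bool) → ℕ
count P = sum (b2n ∘ P)

count-witness : ∀ {n} (P : Fin n → Bool) → 0 < count P → ∃ λ i → P i ≡ true
count-witness {suc n} P pos with P zero in P0
... | true  = zero , P0
... | false = let i , Pi = count-witness (P ∘ suc) pos in suc i , Pi

count-not : ∀ {n} (P : Fin n → Bool) → count (not ∘ P) + count P ≡ n
count-not {n} P = begin
  count (not ∘ P) + count P            ≡⟨ ∑-distrib-+ (b2n ∘ not ∘ P) (b2n ∘ P) ⟨
  ∑[ i < n ] (b2n (not (P i)) + b2n (P i)) ≡⟨ sum-cong-≗ (λ i → one (P i)) ⟩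
  ∑[ i < n ] 1                         ≡⟨ trans (sum-const n 1) (*-identityʳ n) ⟩
  n                                    ∎
  where
  open ≡-Reasoning
  one : ∀ b → b2n (not b) + b2n b ≡ 1
  one true  = refl
  one false = refl

count-∨ : ∀ {n} (P Q : Fin n → Bool) → count (λ i → P i ∨ Q i) ≤ count P + count Q
count-∨ P Q = ≤-trans (sum-mono-≤ (λ i → b2n-∨ (P i) (Q i))) (≤-reflexive (∑-distrib-+ (b2n ∘ P) (b2n ∘ Q)))

count-disjoint-⊆ : ∀ {n} (P Q R : Fin n → Bool) →
  (∀ i → P i ≡ true → R i ≡ true) → (∀ i → Q i ≡ true → R i ≡ true) → (∀ i → P i ≡ true → Q i ≡ true → ⊥) →
  count P + count Q ≤ count R
count-disjoint-⊆ {n} P Q R P⊆R Q⊆R disjoint =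
  ≤-trans (≤-reflexive (sym (∑-distrib-+ (b2n ∘ P) (b2n ∘ Q)))) (sum-mono-≤ pointwise)
  where
  pointwise : ∀ i → b2n (P i) + b2n (Q i) ≤ b2n (R i)
  pointwise i with P i in Pi | Q i in Qi
  ... | false | false = z≤n
  ... | true  | false = ≤-reflexive (cong b2n (sym (P⊆R i Pi)))
  ... | false | true  = ≤-reflexive (cong b2n (sym (Q⊆R i Qi)))
  ... | true  | true  = ⊥-elim (disjoint i Pi Qi)

_≡ᵇ_ : ∀ {n} → Fin n → Fin n → Bool
x ≡ᵇ y = does (x ≟ y)

≡ᵇ-refl : ∀ {n} (x : Fin n) → (x ≡ᵇ x) ≡ true
≡ᵇ-refl x = dec-true (x ≟ x) refl

≢⇒≡ᵇ-false : ∀ {n} {x y : Fin n} → x ≢ y → (x ≡ᵇ y) ≡ false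
≢⇒≡ᵇ-false {x = x} {y} = dec-false (x ≟ y)

≡ᵇ-false⇒≢ : ∀ {n} {x y : Fin n} → (x ≡ᵇ y) ≡ false → x ≢ y
≡ᵇ-false⇒≢ {x = x} x≠y refl with () ← trans (sym (≡ᵇ-refl x)) x≠y

not-≡ᵇ⇒≢ : ∀ {n} {x y : Fin n} → not (x ≡ᵇ y) ≡ true → x ≢ y
not-≡ᵇ⇒≢ {x = x} x≠y refl with () ← trans (sym x≠y) (cong not (≡ᵇ-refl x))

≡ᵇ-sym : ∀ {n} (x y : Fin n) → (x ≡ᵇ y) ≡ (y ≡ᵇ x)
≡ᵇ-sym x y = does-⇔ (mk⇔ sym sym) (x ≟ y) (y ≟ x)

count-≡ᵇ : ∀ {n} (i : Fin n) → count (_≡ᵇ i) ≡ 1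
count-≡ᵇ {suc n} i = begin
  count (_≡ᵇ i)                     ≡⟨ +-identityʳ _ ⟨
  count (_≡ᵇ i) + 0                 ≡⟨ sum-update (b2n ∘ (_≡ᵇ i)) (λ _ → 0) i off-i ⟩
  ∑[ _ < suc n ] 0 + b2n (i ≡ᵇ i)   ≡⟨ cong₂ _+_ (sum-replicate-zero (suc n)) (cong b2n (≡ᵇ-refl i)) ⟩
  1                                 ∎
  where
  open ≡-Reasoning
  off-i : ∀ j → j ≢ i → b2n (j ≡ᵇ i) ≡ 0
  off-i j j≢i = cong b2n (≢⇒≡ᵇ-false j≢i)

count-remove : ∀ {n} (P : Fin n → Bool) i → count P ≤ count (λ j → not (j ≡ᵇ i) ∧ P j) + 1
count-remove {n} P i = begin
  count P                                                   ≤⟨ sum-mono-≤ (λ j → split (j ≡ᵇ i) (P j)) ⟩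
  ∑[ j < n ] (b2n (not (j ≡ᵇ i) ∧ P j) + b2n (j ≡ᵇ i))      ≡⟨ ∑-distrib-+ (λ j → b2n (not (j ≡ᵇ i) ∧ P j)) (b2n ∘ (_≡ᵇ i)) ⟩
  count (λ j → not (j ≡ᵇ i) ∧ P j) + count (_≡ᵇ i)          ≡⟨ cong (count (λ j → not (j ≡ᵇ i) ∧ P j) +_) (count-≡ᵇ i) ⟩
  count (λ j → not (j ≡ᵇ i) ∧ P j) + 1                      ∎
  where
  open ≤-Reasoning
  split : ∀ e p → b2n p ≤ b2n (not e ∧ p) + b2n e
  split false p     = m≤m+n (b2n p) 0
  split true  false = z≤n
  split true  true  = ≤-refl

sum-scaled-≡ᵇ : ∀ {n} a (i : Fin n) → ∑[ v < n ] (a * b2n (v ≡ᵇ i)) ≡ a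
sum-scaled-≡ᵇ a i = trans (sym (*-distribˡ-sum a (b2n ∘ (_≡ᵇ i)))) (trans (cong (a *_) (count-≡ᵇ i)) (*-identityʳ a))

-- Graphs and their complements

deg≡count : ∀ {n} (G : Graph n) u → deg G u ≡ count (adj G u)
deg≡count G u = sum-allFin (b2n ∘ adj G u)

deg-cong : ∀ {n} (G H : Graph n) {u} → (∀ v → adj G u v ≡ adj H u v) → deg G u ≡ deg H u
deg-cong G H {u} G≗H = begin
  deg G u            ≡⟨ deg≡count G u ⟩
  count (adj G u)    ≡⟨ sum-cong-≗ (cong b2n ∘ G≗H) ⟩
  count (adj H u)    ≡⟨ deg≡count H u ⟨
  deg H u            ∎
  where open ≡-Reasoning

Edge-sym : ∀ {n} (G : Graph n) {u v} → Edge G u v → Edge G v u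
Edge-sym G {u} {v} uv = trans (adj-sym G v u) uv

NonEdge-sym : ∀ {n} (G : Graph n) {u v} → NonEdge G u v → NonEdge G v u
NonEdge-sym G {u} {v} uv = trans (adj-sym G v u) uv

Edge⇒≢ : ∀ {n} (G : Graph n) {u v} → Edge G u v → u ≢ v
Edge⇒≢ G {u} uv refl with () ← trans (sym uv) (adj-irrefl G u)

Edge⇒NonEdge⇒≢ : ∀ {n} (G : Graph n) {u v w} → Edge G u v → NonEdge G u w → v ≢ w
Edge⇒NonEdge⇒≢ G uv uw refl with () ← trans (sym uv) uw

has-neighbour : ∀ {n} (G : Graph n) u → 0 < deg G u → ∃ λ w → Edge G u w
has-neighbour G u 0<deg = count-witness (adj G u) (≤-trans 0<deg (≤-reflexive (deg≡count G u)))

complement : ∀ {n} → Graph n → Graph n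
complement G = record
  { adj    = λ w z → not (adj G w z) ∧ not (w ≡ᵇ z)
  ; sym    = λ w z → cong₂ (λ a e → not a ∧ not e) (adj-sym G w z) (≡ᵇ-sym w z)
  ; irrefl = λ w → trans (cong (λ e → not (adj G w w) ∧ not e) (≡ᵇ-refl w)) (∧-zeroʳ _)
  }

Edge-complement : ∀ {n} (G : Graph n) {u v} → u ≢ v → NonEdge G u v → Edge (complement G) u v
Edge-complement G u≢v uv rewrite uv | ≢⇒≡ᵇ-false u≢v = refl

Edge-complement⁻ : ∀ {n} (G : Graph n) {u v} → Edge (complement G) u v → NonEdge G u v
Edge-complement⁻ G {u} {v} uv with adj G u v
... | false = refl

NonEdge-complement⁻ : ∀ {n} (G : Graph n) {u v} → u ≢ v → NonEdge (complement G) u v → Edge G u v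
NonEdge-complement⁻ G {u} {v} u≢v uv =
  adjacent (adj G u v) (trans (cong (λ e → not (adj G u v) ∧ not e) (sym (≢⇒≡ᵇ-false u≢v))) uv)
  where
  adjacent : ∀ a → not a ∧ true ≡ false → a ≡ true
  adjacent true _ = refl

deg-complement : ∀ {n} (G : Graph n) u → deg (complement G) u + suc (deg G u) ≡ n
deg-complement {n} G u = begin
  deg C u + suc (deg G u)
    ≡⟨ cong₂ (λ c d → c + suc d) (deg≡count C u) (deg≡count G u) ⟩
  count (adj C u) + suc (count (adj G u))
    ≡⟨ cong (count (adj C u) +_) (+-comm 1 (count (adj G u))) ⟩
  count (adj C u) + (count (adj G u) + 1)
    ≡⟨ cong (λ k → count (adj C u) + (count (adj G u) + k)) (count-≡ᵇ u) ⟨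
  count (adj C u) + (count (adj G u) + count (_≡ᵇ u))
    ≡⟨ cong (count (adj C u) +_) (∑-distrib-+ (b2n ∘ adj G u) (b2n ∘ (_≡ᵇ u))) ⟨
  count (adj C u) + ∑[ v < n ] (b2n (adj G u v) + b2n (v ≡ᵇ u))
    ≡⟨ ∑-distrib-+ (b2n ∘ adj C u) (λ v → b2n (adj G u v) + b2n (v ≡ᵇ u)) ⟨
  ∑[ v < n ] (b2n (adj C u v) + (b2n (adj G u v) + b2n (v ≡ᵇ u)))
    ≡⟨ sum-cong-≗ (λ v → partition (u ≟ v)) ⟩
  ∑[ v < n ] 1
    ≡⟨ trans (sum-const n 1) (*-identityʳ n) ⟩
  n ∎
  where
  open ≡-Reasoning
  C = complement G
  partition : ∀ {v} → Dec (u ≡ v) → b2n (adj C u v) + (b2n (adj G u v) + b2n (v ≡ᵇ u)) ≡ 1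
  partition (yes refl) rewrite ≡ᵇ-refl u | adj-irrefl G u = refl
  partition {v} (no u≢v) rewrite ≢⇒≡ᵇ-false u≢v | ≢⇒≡ᵇ-false (u≢v ∘ sym) with adj G u v
  ... | true  = refl
  ... | false = refl

count-non-neighbours : ∀ {n} (G : Graph n) u → count (not ∘ adj (complement G) u) ≡ suc (deg G u)
count-non-neighbours {n} G u = +-cancelʳ-≡ (deg C u) _ _ (begin
  count (not ∘ adj C u) + deg C u            ≡⟨ cong (count (not ∘ adj C u) +_) (deg≡count C u) ⟩
  count (not ∘ adj C u) + count (adj C u)    ≡⟨ count-not (adj C u) ⟩
  n                                          ≡⟨ deg-complement G u ⟨
  deg C u + suc (deg G u)                    ≡⟨ +-comm (deg C u) (suc (deg G u)) ⟩
  suc (deg G u) + deg C u                    ∎)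
  where
  open ≡-Reasoning
  C = complement G

-- Toggling a pair

-- {w, z} = {x, y} as a pair of distinct vertices, so that toggling {x, x} changes nothing.
samePair : ∀ {n} → Fin n → Fin n → Fin n → Fin n → Bool
samePair x y w z = ((w ≡ᵇ x ∧ z ≡ᵇ y) ∨ (w ≡ᵇ y ∧ z ≡ᵇ x)) ∧ not (w ≡ᵇ z)

samePair-sym : ∀ {n} (x y w z : Fin n) → samePair x y w z ≡ samePair x y z w
samePair-sym x y w z = cong₂ _∧_
  (trans (∨-comm (w ≡ᵇ x ∧ z ≡ᵇ y) (w ≡ᵇ y ∧ z ≡ᵇ x)) (cong₂ _∨_ (∧-comm (w ≡ᵇ y) (z ≡ᵇ x)) (∧-comm (w ≡ᵇ x) (z ≡ᵇ y))))
  (cong not (≡ᵇ-sym w z))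

samePair-diag : ∀ {n} (x y w : Fin n) → samePair x y w w ≡ false
samePair-diag x y w rewrite ≡ᵇ-refl w = ∧-zeroʳ _

samePair-self : ∀ {n} {x y : Fin n} → x ≢ y → samePair x y x y ≡ true
samePair-self {x = x} {y} x≢y rewrite ≡ᵇ-refl x | ≡ᵇ-refl y | ≢⇒≡ᵇ-false x≢y = refl

samePair-other : ∀ {n} {x y w z : Fin n} → w ≢ x ⊎ z ≢ y → w ≢ y ⊎ z ≢ x → samePair x y w z ≡ false
samePair-other h₁ h₂ =
  cong (_∧ _) (cong₂ _∨_ (∧-≡false (Sum.map ≢⇒≡ᵇ-false ≢⇒≡ᵇ-false h₁)) (∧-≡false (Sum.map ≢⇒≡ᵇ-false ≢⇒≡ᵇ-false h₂)))
  where
  ∧-≡false : ∀ {a b} → a ≡ false ⊎ b ≡ false → a ∧ b ≡ false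
  ∧-≡false (inj₁ refl) = refl
  ∧-≡false {a} (inj₂ refl) = ∧-zeroʳ a

toggle : ∀ {n} → Graph n → Fin n → Fin n → Graph n
toggle G x y = record
  { adj    = λ w z → adj G w z xor samePair x y w z
  ; sym    = λ w z → cong₂ _xor_ (adj-sym G w z) (samePair-sym x y w z)
  ; irrefl = λ w → cong₂ _xor_ (adj-irrefl G w) (samePair-diag x y w)
  }

toggle-self : ∀ {n} (G : Graph n) {x y} → x ≢ y → adj (toggle G x y) x y ≡ not (adj G x y)
toggle-self G {x} {y} x≢y = trans (cong (adj G x y xor_) (samePair-self x≢y)) (xor-comm _ true)

toggle-other : ∀ {n} (G : Graph n) {x y w z} → w ≢ x ⊎ z ≢ y → w ≢ y ⊎ z ≢ x →
               adj (toggle G x y) w z ≡ adj G w z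
toggle-other G {w = w} {z} h₁ h₂ = trans (cong (adj G w z xor_) (samePair-other h₁ h₂)) (xor-identityʳ _)

toggle-fst-away : ∀ {n} (G : Graph n) {x y w z} → w ≢ x → w ≢ y → adj (toggle G x y) w z ≡ adj G w z
toggle-fst-away G w≢x w≢y = toggle-other G (inj₁ w≢x) (inj₁ w≢y)

toggle-snd-away : ∀ {n} (G : Graph n) {x y w z} → z ≢ x → z ≢ y → adj (toggle G x y) w z ≡ adj G w z
toggle-snd-away G z≢x z≢y = toggle-other G (inj₂ z≢y) (inj₂ z≢x)

toggle-flip : ∀ {n} (G : Graph n) x y w z → adj (toggle G x y) w z ≡ adj (toggle G y x) w z
toggle-flip G x y w z = cong (λ b → adj G w z xor (b ∧ not (w ≡ᵇ z))) (∨-comm (w ≡ᵇ x ∧ z ≡ᵇ y) (w ≡ᵇ y ∧ z ≡ᵇ x))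

toggle-Edge : ∀ {n} (G : Graph n) {x y} → x ≢ y → NonEdge G x y → Edge (toggle G x y) x y
toggle-Edge G x≢y xy = trans (toggle-self G x≢y) (cong not xy)

toggle-NonEdge : ∀ {n} (G : Graph n) {x y} → Edge G x y → NonEdge (toggle G x y) x y
toggle-NonEdge G xy = trans (toggle-self G (Edge⇒≢ G xy)) (cong not xy)

deg-toggle-end : ∀ {n} (G : Graph n) {x y} → x ≢ y →
                 deg (toggle G x y) x + b2n (adj G x y) ≡ deg G x + b2n (not (adj G x y))
deg-toggle-end G {x} {y} x≢y = begin
  deg G' x + b2n (adj G x y)            ≡⟨ cong (_+ _) (deg≡count G' x) ⟩
  count (adj G' x) + b2n (adj G x y)    ≡⟨ sum-update (b2n ∘ adj G' x) (b2n ∘ adj G x) y off-y ⟩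
  count (adj G x) + b2n (adj G' x y)    ≡⟨ cong₂ _+_ (deg≡count G x) (cong b2n (sym (toggle-self G x≢y))) ⟨
  deg G x + b2n (not (adj G x y))       ∎
  where
  open ≡-Reasoning
  G' = toggle G x y
  off-y : ∀ z → z ≢ y → b2n (adj G' x z) ≡ b2n (adj G x z)
  off-y z z≢y = cong b2n (toggle-other G (inj₂ z≢y) (inj₁ x≢y))

touches : ∀ {n} → Fin n → Fin n → Fin n → ℕ
touches x y w = b2n (w ≡ᵇ x) + b2n (w ≡ᵇ y)

touches-fst : ∀ {n} {x y : Fin n} → x ≢ y → touches x y x ≡ 1
touches-fst {x = x} x≢y = cong₂ _+_ (cong b2n (≡ᵇ-refl x)) (cong b2n (≢⇒≡ᵇ-false x≢y))

touches-snd : ∀ {n} {x y : Fin n} → x ≢ y → touches x y y ≡ 1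
touches-snd {y = y} x≢y = cong₂ _+_ (cong b2n (≢⇒≡ᵇ-false (x≢y ∘ sym))) (cong b2n (≡ᵇ-refl y))

touches-away : ∀ {n} {x y w : Fin n} → w ≢ x → w ≢ y → touches x y w ≡ 0
touches-away w≢x w≢y = cong₂ _+_ (cong b2n (≢⇒≡ᵇ-false w≢x)) (cong b2n (≢⇒≡ᵇ-false w≢y))

deg-toggle : ∀ {n} (G : Graph n) {x y} → x ≢ y → ∀ w →
  deg (toggle G x y) w + touches x y w * b2n (adj G x y) ≡ deg G w + touches x y w * b2n (not (adj G x y))
deg-toggle G {x} {y} x≢y w = by-cases (w ≟ x) (w ≟ y)
  where
  open ≡-Reasoning
  once : ∀ {t d d' b b'} → t ≡ 1 → d' + b ≡ d + b' → d' + t * b ≡ d + t * b'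
  once {d = d} {d'} {b} {b'} refl e = trans (cong (d' +_) (+-identityʳ b)) (trans e (cong (d +_) (sym (+-identityʳ b'))))
  never : ∀ {t d d' b b'} → t ≡ 0 → d' ≡ d → d' + t * b ≡ d + t * b'
  never refl refl = refl
  by-cases : Dec (w ≡ x) → Dec (w ≡ y) →
    deg (toggle G x y) w + touches x y w * b2n (adj G x y) ≡ deg G w + touches x y w * b2n (not (adj G x y))
  by-cases (yes refl) _ = once (touches-fst x≢y) (deg-toggle-end G x≢y)
  by-cases (no w≢x) (yes refl) = once (touches-snd x≢y) (begin
    deg (toggle G x y) y + b2n (adj G x y)
      ≡⟨ cong₂ (λ d b → d + b2n b) (deg-cong (toggle G x y) (toggle G y x) (toggle-flip G x y y)) (adj-sym G x y) ⟩
    deg (toggle G y x) y + b2n (adj G y x)    ≡⟨ deg-toggle-end G w≢x ⟩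
    deg G y + b2n (not (adj G y x))           ≡⟨ cong (λ b → deg G y + b2n (not b)) (adj-sym G y x) ⟩
    deg G y + b2n (not (adj G x y))           ∎)
  by-cases (no w≢x) (no w≢y) =
    never (touches-away w≢x w≢y) (deg-cong (toggle G x y) G (λ z → toggle-other G (inj₁ w≢x) (inj₁ w≢y)))

deg-toggle-edge : ∀ {n} (G : Graph n) {x y} → Edge G x y → ∀ w → deg (toggle G x y) w + touches x y w ≡ deg G w
deg-toggle-edge G {x} {y} xy w = begin
  d' + t                                   ≡⟨ cong (d' +_) (*-identityʳ t) ⟨
  d' + t * 1                               ≡⟨ cong (λ b → d' + t * b2n b) xy ⟨
  d' + t * b2n (adj G x y)                 ≡⟨ deg-toggle G (Edge⇒≢ G xy) w ⟩
  d + t * b2n (not (adj G x y))            ≡⟨ cong (λ b → d + t * b2n (not b)) xy ⟩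
  d + t * 0                                ≡⟨ trans (cong (d +_) (*-zeroʳ t)) (+-identityʳ d) ⟩
  d                                        ∎
  where
  open ≡-Reasoning
  d' = deg (toggle G x y) w
  d  = deg G w
  t  = touches x y w

deg-toggle-nonEdge : ∀ {n} (G : Graph n) {x y} → x ≢ y → NonEdge G x y → ∀ w →
                     deg (toggle G x y) w ≡ deg G w + touches x y w
deg-toggle-nonEdge G {x} {y} x≢y xy w = begin
  d'                                       ≡⟨ trans (sym (+-identityʳ d')) (cong (d' +_) (sym (*-zeroʳ t))) ⟩
  d' + t * 0                               ≡⟨ cong (λ b → d' + t * b2n b) xy ⟨
  d' + t * b2n (adj G x y)                 ≡⟨ deg-toggle G x≢y w ⟩
  d + t * b2n (not (adj G x y))            ≡⟨ cong (λ b → d + t * b2n (not b)) xy ⟩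
  d + t * 1                                ≡⟨ cong (d +_) (*-identityʳ t) ⟩
  d + t                                    ∎
  where
  open ≡-Reasoning
  d' = deg (toggle G x y) w
  d  = deg G w
  t  = touches x y w

sum-touches : ∀ {n} (x y : Fin n) → sum (touches x y) ≡ 2
sum-touches x y = trans (∑-distrib-+ (b2n ∘ (_≡ᵇ x)) (b2n ∘ (_≡ᵇ y))) (cong₂ _+_ (count-≡ᵇ x) (count-≡ᵇ y))

sum-samePair : ∀ {n} (x y : Fin n) → ∑[ u < n ] ∑[ v < n ] b2n (samePair x y u v) ≤ 2
sum-samePair {n} x y = begin
  ∑[ u < n ] ∑[ v < n ] b2n (samePair x y u v)
    ≤⟨ sum-mono-≤ (λ u → sum-mono-≤ (λ v → pairs u v)) ⟩
  ∑[ u < n ] ∑[ v < n ] (b2n (u ≡ᵇ x) * b2n (v ≡ᵇ y) + b2n (u ≡ᵇ y) * b2n (v ≡ᵇ x))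
    ≡⟨ sum-cong-≗ (λ u → trans (∑-distrib-+ (λ v → b2n (u ≡ᵇ x) * b2n (v ≡ᵇ y)) (λ v → b2n (u ≡ᵇ y) * b2n (v ≡ᵇ x)))
                                (cong₂ _+_ (sum-scaled-≡ᵇ (b2n (u ≡ᵇ x)) y) (sum-scaled-≡ᵇ (b2n (u ≡ᵇ y)) x))) ⟩
  sum (touches x y)
    ≡⟨ sum-touches x y ⟩
  2 ∎
  where
  open ≤-Reasoning
  pairs : ∀ u v → b2n (samePair x y u v) ≤ b2n (u ≡ᵇ x) * b2n (v ≡ᵇ y) + b2n (u ≡ᵇ y) * b2n (v ≡ᵇ x)
  pairs u v = begin
    b2n (samePair x y u v)                                  ≤⟨ b2n-∧-≤ˡ ((u ≡ᵇ x ∧ v ≡ᵇ y) ∨ (u ≡ᵇ y ∧ v ≡ᵇ x)) _ ⟩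
    b2n ((u ≡ᵇ x ∧ v ≡ᵇ y) ∨ (u ≡ᵇ y ∧ v ≡ᵇ x))             ≤⟨ b2n-∨ (u ≡ᵇ x ∧ v ≡ᵇ y) (u ≡ᵇ y ∧ v ≡ᵇ x) ⟩
    b2n (u ≡ᵇ x ∧ v ≡ᵇ y) + b2n (u ≡ᵇ y ∧ v ≡ᵇ x)           ≡⟨ cong₂ _+_ (b2n-∧ (u ≡ᵇ x) (v ≡ᵇ y)) (b2n-∧ (u ≡ᵇ y) (v ≡ᵇ x)) ⟩
    b2n (u ≡ᵇ x) * b2n (v ≡ᵇ y) + b2n (u ≡ᵇ y) * b2n (v ≡ᵇ x) ∎

symDiffSize≡ : ∀ {n} (G H : Graph n) →
  symDiffSize G H ≡ ∑[ u < n ] ∑[ v < n ] b2n ((toℕ u <ᵇ toℕ v) ∧ (adj G u v xor adj H u v))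
symDiffSize≡ {n} G H =
  trans (sum-allFin (λ u → ListAction.sum (map (differ u) (allFin n)))) (sum-cong-≗ (sum-allFin ∘ differ))
  where
  differ : Fin n → Fin n → ℕ
  differ u v = b2n ((toℕ u <ᵇ toℕ v) ∧ (adj G u v xor adj H u v))

symDiffSize-self : ∀ {n} (G : Graph n) → symDiffSize G G ≡ 0
symDiffSize-self {n} G = begin
  symDiffSize G G          ≡⟨ symDiffSize≡ G G ⟩
  ∑[ u < n ] ∑[ v < n ] b2n ((toℕ u <ᵇ toℕ v) ∧ (adj G u v xor adj G u v))
    ≡⟨ sum-cong-≗ (λ u → trans (sum-cong-≗ (λ v → none (toℕ u <ᵇ toℕ v) (adj G u v))) (sum-replicate-zero n)) ⟩
  ∑[ u < n ] 0             ≡⟨ sum-replicate-zero n ⟩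
  0                        ∎
  where
  open ≡-Reasoning
  none : ∀ c a → b2n (c ∧ (a xor a)) ≡ 0
  none c a = cong b2n (trans (cong (c ∧_) (xor-same a)) (∧-zeroʳ c))

symDiffSize-toggle : ∀ {n} (G H : Graph n) x y → symDiffSize G (toggle H x y) ≤ symDiffSize G H + 2
symDiffSize-toggle {n} G H x y = begin
  symDiffSize G (toggle H x y)
    ≡⟨ symDiffSize≡ G (toggle H x y) ⟩
  ∑[ u < n ] ∑[ v < n ] b2n (lt u v ∧ (adj G u v xor (adj H u v xor samePair x y u v)))
    ≤⟨ sum-mono-≤ (λ u → sum-mono-≤ (λ v → step (lt u v) (adj G u v) (adj H u v) (samePair x y u v))) ⟩
  ∑[ u < n ] ∑[ v < n ] (differ u v + pair u v)
    ≡⟨ trans (sum-cong-≗ (λ u → ∑-distrib-+ (differ u) (pair u))) (∑-distrib-+ (sum ∘ differ) (sum ∘ pair)) ⟩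
  ∑[ u < n ] ∑[ v < n ] differ u v + ∑[ u < n ] ∑[ v < n ] pair u v
    ≤⟨ +-mono-≤ (≤-reflexive (sym (symDiffSize≡ G H))) (sum-samePair x y) ⟩
  symDiffSize G H + 2 ∎
  where
  open ≤-Reasoning
  lt : Fin n → Fin n → Bool
  lt u v = toℕ u <ᵇ toℕ v
  differ pair : Fin n → Fin n → ℕ
  differ u v = b2n (lt u v ∧ (adj G u v xor adj H u v))
  pair u v = b2n (samePair x y u v)
  step : ∀ c g h m → b2n (c ∧ (g xor (h xor m))) ≤ b2n (c ∧ (g xor h)) + b2n m
  step c g h false rewrite xor-identityʳ h = m≤m+n _ 0
  step c g h true  = ≤-trans (b2n≤1 _) (m≤n+m 1 _)

-- Switching along alternating cycles

record DegreeShift {n} (G H : Graph n) (x z : Fin n) : Set where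
  field shift : ∀ w → deg H w + b2n (w ≡ᵇ x) ≡ deg G w + b2n (w ≡ᵇ z)
open DegreeShift

DegreeShift-trans : ∀ {n} {G H K : Graph n} {x y z} → DegreeShift G H x y → DegreeShift H K y z → DegreeShift G K x z
DegreeShift-trans {G = G} {H} {K} {x} {y} {z} G→H H→K .shift w = +-cancelʳ-≡ [y] _ _ (begin
  deg K w + [x] + [y]     ≡⟨ xy∙z≈xz∙y (deg K w) [x] [y] ⟩
  deg K w + [y] + [x]     ≡⟨ cong (_+ [x]) (shift H→K w) ⟩
  deg H w + [z] + [x]     ≡⟨ xy∙z≈xz∙y (deg H w) [z] [x] ⟩
  deg H w + [x] + [z]     ≡⟨ cong (_+ [z]) (shift G→H w) ⟩
  deg G w + [y] + [z]     ≡⟨ xy∙z≈xz∙y (deg G w) [y] [z] ⟩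
  deg G w + [z] + [y]     ∎)
  where
  open ≡-Reasoning
  [x] = b2n (w ≡ᵇ x)
  [y] = b2n (w ≡ᵇ y)
  [z] = b2n (w ≡ᵇ z)

DegreeShift-cycle : ∀ {n} {G H : Graph n} {x} → DegreeShift G H x x → ∀ w → deg H w ≡ deg G w
DegreeShift-cycle {x = x} G→H w = +-cancelʳ-≡ (b2n (w ≡ᵇ x)) _ _ (shift G→H w)

pathSwitch : ∀ {n} → Graph n → Fin n → Fin n → Fin n → Graph n
pathSwitch G x y z = toggle (toggle G x y) y z

DegreeShift-pathSwitch : ∀ {n} (G : Graph n) {x y z} → Edge G x y → y ≢ z → NonEdge (toggle G x y) y z →
                         DegreeShift G (pathSwitch G x y z) x z
DegreeShift-pathSwitch G {x} {y} {z} xy y≢z yz .shift w = begin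
  deg (pathSwitch G x y z) w + [x]          ≡⟨ cong (_+ [x]) (deg-toggle-nonEdge (toggle G x y) y≢z yz w) ⟩
  deg (toggle G x y) w + ([y] + [z]) + [x]  ≡⟨ shuffle (deg (toggle G x y) w) [x] [y] [z] ⟩
  deg (toggle G x y) w + ([x] + [y]) + [z]  ≡⟨ cong (_+ [z]) (deg-toggle-edge G xy w) ⟩
  deg G w + [z]                             ∎
  where
  open ≡-Reasoning
  [x] = b2n (w ≡ᵇ x)
  [y] = b2n (w ≡ᵇ y)
  [z] = b2n (w ≡ᵇ z)
  shuffle : ∀ d a b c → d + (b + c) + a ≡ d + (a + b) + c
  shuffle = solve-∀

symDiffSize-pathSwitch : ∀ {n} (G H : Graph n) x y z → symDiffSize G (pathSwitch H x y z) ≤ symDiffSize G H + 4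
symDiffSize-pathSwitch G H x y z = begin
  symDiffSize G (pathSwitch H x y z)    ≤⟨ symDiffSize-toggle G (toggle H x y) y z ⟩
  symDiffSize G (toggle H x y) + 2      ≤⟨ +-monoˡ-≤ 2 (symDiffSize-toggle G H x y) ⟩
  symDiffSize G H + 2 + 2               ≡⟨ +-assoc (symDiffSize G H) 2 2 ⟩
  symDiffSize G H + 4                   ∎
  where open ≤-Reasoning

record Deletion {n} (G : Graph n) (u v : Fin n) : Set where
  field
    graph        : Graph n
    same-degrees : ∀ w → deg graph w ≡ deg G w
    close        : symDiffSize G graph ≤ 12
    deleted      : NonEdge graph u v
    keeps        : ∀ w → w ≢ v → Edge G u w → Edge graph u w

record Insertion {n} (G : Graph n) (u v : Fin n) : Set where
  field
    graph        : Graph n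
    same-degrees : ∀ w → deg graph w ≡ deg G w
    close        : symDiffSize G graph ≤ 12
    inserted     : Edge graph u v

record AlternatingSquare {n} (G : Graph n) (p₀ p₁ p₂ p₃ : Fin n) : Set where
  field
    e₀₁   : Edge G p₀ p₁
    e₁₂   : NonEdge G p₁ p₂
    e₂₃   : Edge G p₂ p₃
    e₃₀   : NonEdge G p₃ p₀
    p₁≢p₂ : p₁ ≢ p₂
    p₃≢p₀ : p₃ ≢ p₀

module _ {n} {G : Graph n} {p₀ p₁ p₂ p₃} (S : AlternatingSquare G p₀ p₁ p₂ p₃) where
  open AlternatingSquare S

  -- The pairs are toggled in cyclic order; a primed fact says that a pair still has its
  -- original status when its turn comes.
  private
    G₁ = toggle G p₀ p₁
    G₂ = toggle G₁ p₁ p₂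
    G₃ = toggle G₂ p₂ p₃
    G₄ = toggle G₃ p₃ p₀
    p₀≢p₁ = Edge⇒≢ G e₀₁
    p₂≢p₃ = Edge⇒≢ G e₂₃
    p₀≢p₂ = Edge⇒NonEdge⇒≢ G (Edge-sym G e₀₁) e₁₂
    p₁≢p₃ = Edge⇒NonEdge⇒≢ G e₀₁ (NonEdge-sym G e₃₀)

    e₁₂′ : NonEdge G₁ p₁ p₂
    e₁₂′ = trans (toggle-snd-away G (p₀≢p₂ ∘ sym) (p₁≢p₂ ∘ sym)) e₁₂

    e₂₃′ : Edge G₂ p₂ p₃
    e₂₃′ = trans (toggle-snd-away G₁ (p₁≢p₃ ∘ sym) (p₂≢p₃ ∘ sym)) (trans (toggle-fst-away G (p₀≢p₂ ∘ sym) (p₁≢p₂ ∘ sym)) e₂₃)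

    e₃₀′ : NonEdge G₃ p₃ p₀
    e₃₀′ = trans (toggle-snd-away G₂ p₀≢p₂ (p₃≢p₀ ∘ sym))
          (trans (toggle-snd-away G₁ p₀≢p₁ p₀≢p₂)
          (trans (toggle-fst-away G (p₃≢p₀) (p₁≢p₃ ∘ sym)) e₃₀))

    p₀-row : ∀ w → w ≢ p₀ → w ≢ p₁ → w ≢ p₃ → adj G₄ p₀ w ≡ adj G p₀ w
    p₀-row w w≢p₀ w≢p₁ w≢p₃ =
      trans (toggle-snd-away G₃ w≢p₃ w≢p₀)
      (trans (toggle-fst-away G₂ p₀≢p₂ (p₃≢p₀ ∘ sym))
      (trans (toggle-fst-away G₁ p₀≢p₁ p₀≢p₂)
      (toggle-snd-away G w≢p₀ w≢p₁)))

    deleted : NonEdge G₄ p₀ p₁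
    deleted = trans (toggle-snd-away G₃ p₁≢p₃ (p₀≢p₁ ∘ sym))
             (trans (toggle-fst-away G₂ p₀≢p₂ (p₃≢p₀ ∘ sym))
             (trans (toggle-fst-away G₁ p₀≢p₁ p₀≢p₂) (toggle-NonEdge G e₀₁)))

    same-degrees : ∀ w → deg G₄ w ≡ deg G w
    same-degrees = DegreeShift-cycle (DegreeShift-trans
      (DegreeShift-pathSwitch G e₀₁ p₁≢p₂ e₁₂′) (DegreeShift-pathSwitch G₂ e₂₃′ p₃≢p₀ e₃₀′))

    close : symDiffSize G G₄ ≤ 12
    close = begin
      symDiffSize G G₄       ≤⟨ symDiffSize-pathSwitch G G₂ p₂ p₃ p₀ ⟩
      symDiffSize G G₂ + 4   ≤⟨ +-monoˡ-≤ 4 (symDiffSize-pathSwitch G G p₀ p₁ p₂) ⟩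
      symDiffSize G G + 4 + 4 ≡⟨ cong (λ d → d + 4 + 4) (symDiffSize-self G) ⟩
      8                      ≤⟨ m≤m+n 8 4 ⟩
      12                     ∎
      where open ≤-Reasoning

  square-deletion : Deletion G p₀ p₁
  square-deletion = record
    { graph        = G₄
    ; same-degrees = same-degrees
    ; close        = close
    ; deleted      = deleted
    ; keeps        = λ w w≢p₁ p₀w → trans (p₀-row w (Edge⇒≢ G p₀w ∘ sym) w≢p₁ (Edge⇒NonEdge⇒≢ G p₀w (NonEdge-sym G e₃₀))) p₀w
    }

  square-insertion : Insertion G p₃ p₀
  square-insertion = record
    { graph        = G₄
    ; same-degrees = same-degrees
    ; close        = close
    ; inserted     = toggle-Edge G₃ p₃≢p₀ e₃₀′
    }

-- Distinctness is required only where it does not follow from the alternation; p₂ = p₅ is allowed.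
record AlternatingHexagon {n} (G : Graph n) (p₀ p₁ p₂ p₃ p₄ p₅ : Fin n) : Set where
  field
    e₀₁   : Edge G p₀ p₁
    e₁₂   : NonEdge G p₁ p₂
    e₂₃   : Edge G p₂ p₃
    e₃₄   : NonEdge G p₃ p₄
    e₄₅   : Edge G p₄ p₅
    e₅₀   : NonEdge G p₅ p₀
    p₁≢p₂ : p₁ ≢ p₂
    p₃≢p₄ : p₃ ≢ p₄
    p₅≢p₀ : p₅ ≢ p₀
    p₀≢p₃ : p₀ ≢ p₃
    p₁≢p₄ : p₁ ≢ p₄

module _ {n} {G : Graph n} {p₀ p₁ p₂ p₃ p₄ p₅} (H : AlternatingHexagon G p₀ p₁ p₂ p₃ p₄ p₅) where
  open AlternatingHexagon H

  private
    G₁ = toggle G p₀ p₁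
    G₂ = toggle G₁ p₁ p₂
    G₃ = toggle G₂ p₂ p₃
    G₄ = toggle G₃ p₃ p₄
    G₅ = toggle G₄ p₄ p₅
    G₆ = toggle G₅ p₅ p₀
    p₀≢p₁ = Edge⇒≢ G e₀₁
    p₂≢p₃ = Edge⇒≢ G e₂₃
    p₄≢p₅ = Edge⇒≢ G e₄₅
    p₀≢p₂ = Edge⇒NonEdge⇒≢ G (Edge-sym G e₀₁) e₁₂
    p₃≢p₁ = Edge⇒NonEdge⇒≢ G e₂₃ (NonEdge-sym G e₁₂)
    p₂≢p₄ = Edge⇒NonEdge⇒≢ G (Edge-sym G e₂₃) e₃₄
    p₅≢p₃ = Edge⇒NonEdge⇒≢ G e₄₅ (NonEdge-sym G e₃₄)
    p₄≢p₀ = Edge⇒NonEdge⇒≢ G (Edge-sym G e₄₅) e₅₀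
    p₁≢p₅ = Edge⇒NonEdge⇒≢ G e₀₁ (NonEdge-sym G e₅₀)

    e₁₂′ : NonEdge G₁ p₁ p₂
    e₁₂′ = trans (toggle-snd-away G (p₀≢p₂ ∘ sym) (p₁≢p₂ ∘ sym)) e₁₂

    e₂₃′ : Edge G₂ p₂ p₃
    e₂₃′ = trans (toggle-snd-away G₁ p₃≢p₁ (p₂≢p₃ ∘ sym))
          (trans (toggle-fst-away G (p₀≢p₂ ∘ sym) (p₁≢p₂ ∘ sym)) e₂₃)

    e₃₄′ : NonEdge G₃ p₃ p₄
    e₃₄′ = trans (toggle-snd-away G₂ (p₂≢p₄ ∘ sym) (p₃≢p₄ ∘ sym))
          (trans (toggle-fst-away G₁ p₃≢p₁ (p₂≢p₃ ∘ sym))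
          (trans (toggle-fst-away G (p₀≢p₃ ∘ sym) p₃≢p₁) e₃₄))

    e₄₅′ : Edge G₄ p₄ p₅
    e₄₅′ = trans (toggle-snd-away G₃ p₅≢p₃ (p₄≢p₅ ∘ sym))
          (trans (toggle-fst-away G₂ (p₂≢p₄ ∘ sym) (p₃≢p₄ ∘ sym))
          (trans (toggle-fst-away G₁ (p₁≢p₄ ∘ sym) (p₂≢p₄ ∘ sym))
          (trans (toggle-fst-away G p₄≢p₀ (p₁≢p₄ ∘ sym)) e₄₅)))

    e₅₀′ : NonEdge G₅ p₅ p₀
    e₅₀′ = trans (toggle-snd-away G₄ (p₄≢p₀ ∘ sym) (p₅≢p₀ ∘ sym))
          (trans (toggle-snd-away G₃ p₀≢p₃ (p₄≢p₀ ∘ sym))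
          (trans (toggle-snd-away G₂ p₀≢p₂ p₀≢p₃)
          (trans (toggle-snd-away G₁ p₀≢p₁ p₀≢p₂)
          (trans (toggle-fst-away G p₅≢p₀ (p₁≢p₅ ∘ sym)) e₅₀))))

    p₀-row : ∀ w → w ≢ p₀ → w ≢ p₁ → w ≢ p₅ → adj G₆ p₀ w ≡ adj G p₀ w
    p₀-row w w≢p₀ w≢p₁ w≢p₅ =
      trans (toggle-snd-away G₅ w≢p₅ w≢p₀)
      (trans (toggle-fst-away G₄ (p₄≢p₀ ∘ sym) (p₅≢p₀ ∘ sym))
      (trans (toggle-fst-away G₃ p₀≢p₃ (p₄≢p₀ ∘ sym))
      (trans (toggle-fst-away G₂ p₀≢p₂ p₀≢p₃)
      (trans (toggle-fst-away G₁ p₀≢p₁ p₀≢p₂)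
      (toggle-snd-away G w≢p₀ w≢p₁)))))

    deleted : NonEdge G₆ p₀ p₁
    deleted = trans (toggle-snd-away G₅ p₁≢p₅ (p₀≢p₁ ∘ sym))
             (trans (toggle-fst-away G₄ (p₄≢p₀ ∘ sym) (p₅≢p₀ ∘ sym))
             (trans (toggle-fst-away G₃ p₀≢p₃ (p₄≢p₀ ∘ sym))
             (trans (toggle-fst-away G₂ p₀≢p₂ p₀≢p₃)
             (trans (toggle-fst-away G₁ p₀≢p₁ p₀≢p₂) (toggle-NonEdge G e₀₁)))))

    same-degrees : ∀ w → deg G₆ w ≡ deg G w
    same-degrees = DegreeShift-cycle (DegreeShift-trans (DegreeShift-trans
      (DegreeShift-pathSwitch G e₀₁ p₁≢p₂ e₁₂′)
      (DegreeShift-pathSwitch G₂ e₂₃′ p₃≢p₄ e₃₄′))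
      (DegreeShift-pathSwitch G₄ e₄₅′ p₅≢p₀ e₅₀′))

    close : symDiffSize G G₆ ≤ 12
    close = begin
      symDiffSize G G₆            ≤⟨ symDiffSize-pathSwitch G G₄ p₄ p₅ p₀ ⟩
      symDiffSize G G₄ + 4        ≤⟨ +-monoˡ-≤ 4 (symDiffSize-pathSwitch G G₂ p₂ p₃ p₄) ⟩
      symDiffSize G G₂ + 4 + 4    ≤⟨ +-monoˡ-≤ 4 (+-monoˡ-≤ 4 (symDiffSize-pathSwitch G G p₀ p₁ p₂)) ⟩
      symDiffSize G G + 4 + 4 + 4 ≡⟨ cong (λ d → d + 4 + 4 + 4) (symDiffSize-self G) ⟩
      12                          ∎
      where open ≤-Reasoning

  hexagon-deletion : Deletion G p₀ p₁
  hexagon-deletion = record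
    { graph        = G₆
    ; same-degrees = same-degrees
    ; close        = close
    ; deleted      = deleted
    ; keeps        = λ w w≢p₁ p₀w → trans (p₀-row w (Edge⇒≢ G p₀w ∘ sym) w≢p₁ (Edge⇒NonEdge⇒≢ G p₀w (NonEdge-sym G e₅₀))) p₀w
    }

  hexagon-insertion : Insertion G p₃ p₄
  hexagon-insertion = record
    { graph        = G₆
    ; same-degrees = same-degrees
    ; close        = close
    ; inserted     = trans (toggle-fst-away G₅ (p₅≢p₃ ∘ sym) (p₀≢p₃ ∘ sym))
                     (trans (toggle-fst-away G₄ p₃≢p₄ (p₅≢p₃ ∘ sym)) (toggle-Edge G₃ p₃≢p₄ e₃₄′))
    }

complement-square : ∀ {n} {G : Graph n} {p₀ p₁ p₂ p₃} →
  AlternatingSquare (complement G) p₀ p₁ p₂ p₃ → AlternatingSquare G p₁ p₂ p₃ p₀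
complement-square {G = G} S = record
  { e₀₁   = NonEdge-complement⁻ G p₁≢p₂ e₁₂
  ; e₁₂   = Edge-complement⁻ G e₂₃
  ; e₂₃   = NonEdge-complement⁻ G p₃≢p₀ e₃₀
  ; e₃₀   = Edge-complement⁻ G e₀₁
  ; p₁≢p₂ = Edge⇒≢ (complement G) e₂₃
  ; p₃≢p₀ = Edge⇒≢ (complement G) e₀₁
  }
  where open AlternatingSquare S

complement-hexagon : ∀ {n} {G : Graph n} {p₀ p₁ p₂ p₃ p₄ p₅} →
  AlternatingHexagon (complement G) p₀ p₁ p₂ p₃ p₄ p₅ → AlternatingHexagon G p₃ p₄ p₅ p₀ p₁ p₂
complement-hexagon {G = G} H = record
  { e₀₁   = NonEdge-complement⁻ G p₃≢p₄ e₃₄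
  ; e₁₂   = Edge-complement⁻ G e₄₅
  ; e₂₃   = NonEdge-complement⁻ G p₅≢p₀ e₅₀
  ; e₃₄   = Edge-complement⁻ G e₀₁
  ; e₄₅   = NonEdge-complement⁻ G p₁≢p₂ e₁₂
  ; e₅₀   = Edge-complement⁻ G e₂₃
  ; p₁≢p₂ = Edge⇒≢ (complement G) e₄₅
  ; p₃≢p₄ = Edge⇒≢ (complement G) e₀₁
  ; p₅≢p₀ = Edge⇒≢ (complement G) e₂₃
  ; p₀≢p₃ = p₀≢p₃ ∘ sym
  ; p₁≢p₄ = p₁≢p₄ ∘ sym
  }
  where open AlternatingHexagon H

Switchable : ∀ {n} → Graph n → Fin n → Fin n → Set
Switchable G u v = (∃₂ λ a d → AlternatingSquare G u v a d)
                 ⊎ (∃₂ λ a b → ∃₂ λ c d → AlternatingHexagon G u v a b c d)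

Switchable⇒Deletion : ∀ {n} {G : Graph n} {u v} → Switchable G u v → Deletion G u v
Switchable⇒Deletion (inj₁ (_ , _ , S))         = square-deletion S
Switchable⇒Deletion (inj₂ (_ , _ , _ , _ , H)) = hexagon-deletion H

complement-Switchable⇒Insertion : ∀ {n} {G : Graph n} {u v} → Switchable (complement G) u v → Insertion G u v
complement-Switchable⇒Insertion (inj₁ (_ , _ , S))         = square-insertion (complement-square S)
complement-Switchable⇒Insertion (inj₂ (_ , _ , _ , _ , H)) = hexagon-insertion (complement-hexagon H)

-- Finding alternating cycles by double counting

count-edges-from : ∀ {n} (G : Graph n) {δ Δ} → (∀ w → δ ≤ deg G w) → (∀ w → deg G w ≤ Δ) →
  (P Q : Fin n → Bool) → (∀ z w → P z ≡ true → Q w ≡ true → NonEdge G z w) →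
  δ * count P ≤ Δ * count (not ∘ Q)
count-edges-from {n} G {δ} {Δ} lo hi P Q no-edge = begin
  δ * count P                                       ≡⟨ *-distribˡ-sum δ (b2n ∘ P) ⟩
  ∑[ z < n ] (δ * [P] z)                            ≤⟨ sum-mono-≤ degree-of-P ⟩
  ∑[ z < n ] ∑[ w < n ] ([P] z * [adj] z w)         ≤⟨ sum-mono-≤ (λ z → sum-mono-≤ (λ w → into-¬Q z w)) ⟩
  ∑[ z < n ] ∑[ w < n ] ([adj] z w * [¬Q] w)        ≡⟨ ∑-comm (λ z w → [adj] z w * [¬Q] w) ⟩
  ∑[ w < n ] ∑[ z < n ] ([adj] z w * [¬Q] w)        ≡⟨ sum-cong-≗ column ⟨
  ∑[ w < n ] (deg G w * [¬Q] w)                     ≤⟨ sum-mono-≤ (λ w → *-monoˡ-≤ ([¬Q] w) (hi w)) ⟩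
  ∑[ w < n ] (Δ * [¬Q] w)                           ≡⟨ *-distribˡ-sum Δ [¬Q] ⟨
  Δ * count (not ∘ Q)                               ∎
  where
  open ≤-Reasoning
  [P] [¬Q] : Fin n → ℕ
  [P] z = b2n (P z)
  [¬Q] w = b2n (not (Q w))
  [adj] : Fin n → Fin n → ℕ
  [adj] z w = b2n (adj G z w)
  degree-of-P : ∀ z → δ * [P] z ≤ ∑[ w < n ] ([P] z * [adj] z w)
  degree-of-P z = begin
    δ * [P] z               ≡⟨ *-comm δ ([P] z) ⟩
    [P] z * δ               ≤⟨ *-monoʳ-≤ ([P] z) (lo z) ⟩
    [P] z * deg G z         ≡⟨ cong ([P] z *_) (deg≡count G z) ⟩
    [P] z * count (adj G z) ≡⟨ *-distribˡ-sum ([P] z) ([adj] z) ⟩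
    ∑[ w < n ] ([P] z * [adj] z w) ∎
  into-¬Q : ∀ z w → [P] z * [adj] z w ≤ [adj] z w * [¬Q] w
  into-¬Q z w with P z in Pz | adj G z w in zw | Q w in Qw
  ... | false | _     | _     = z≤n
  ... | true  | false | _     = z≤n
  ... | true  | true  | false = ≤-refl
  ... | true  | true  | true  with () ← trans (sym zw) (no-edge z w Pz Qw)
  column : ∀ w → deg G w * [¬Q] w ≡ ∑[ z < n ] ([adj] z w * [¬Q] w)
  column w = begin-equality
    deg G w * [¬Q] w                     ≡⟨ cong (_* [¬Q] w) (deg≡count G w) ⟩
    count (adj G w) * [¬Q] w             ≡⟨ *-distribʳ-sum ([¬Q] w) ([adj] w) ⟩
    ∑[ z < n ] ([adj] w z * [¬Q] w)      ≡⟨ sum-cong-≗ (λ z → cong (λ b → b2n b * [¬Q] w) (adj-sym G w z)) ⟩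
    ∑[ z < n ] ([adj] z w * [¬Q] w)      ∎

edge-between : ∀ {n} (G : Graph n) {δ Δ} → (∀ w → δ ≤ deg G w) → (∀ w → deg G w ≤ Δ) →
  (P Q : Fin n → Bool) → Δ * count (not ∘ Q) < δ * count P →
  ∃₂ λ z w → P z ≡ true × Q w ≡ true × Edge G z w
edge-between G lo hi P Q bound
  with any? (λ z → any? (λ w → (P z ≟ᴮ true) ×-dec (Q w ≟ᴮ true) ×-dec (adj G z w ≟ᴮ true)))
... | yes (z , w , Pz , Qw , zw) = z , w , Pz , Qw , zw
... | no none = contradiction (count-edges-from G lo hi P Q no-edge) (<⇒≱ bound)
  where
  no-edge : ∀ z w → P z ≡ true → Q w ≡ true → NonEdge G z w
  no-edge z w Pz Qw = ¬-not (λ zw → none (z , w , Pz , Qw , zw))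

-- The order is such that the degrees of the complement lie in [y + 1, y + 1 + σ].
record DegreeWindow {n} (G : Graph n) (x σ y : ℕ) : Set where
  field
    order : n ≡ suc x + σ + suc (suc y)
    lower : ∀ w → suc x ≤ deg G w
    upper : ∀ w → deg G w ≤ suc x + σ

complement-window : ∀ {n} {G : Graph n} {x σ y} → DegreeWindow G x σ y → DegreeWindow (complement G) y σ x
complement-window {n} {G} {x} {σ} {y} W = record
  { order = trans order (swap x σ y)
  ; lower = λ w → +-cancelʳ-≤ (suc (suc x + σ)) (suc y) (deg (complement G) w) (begin
      suc y + suc (suc x + σ)                 ≡⟨ swap′ x σ y ⟩
      suc x + σ + suc (suc y)                 ≡⟨ order ⟨
      n                                       ≡⟨ deg-complement G w ⟨
      deg (complement G) w + suc (deg G w)    ≤⟨ +-monoʳ-≤ (deg (complement G) w) (s≤s (upper w)) ⟩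
      deg (complement G) w + suc (suc x + σ)  ∎)
  ; upper = λ w → +-cancelʳ-≤ (suc (suc x)) (deg (complement G) w) (suc y + σ) (begin
      deg (complement G) w + suc (suc x)      ≤⟨ +-monoʳ-≤ (deg (complement G) w) (s≤s (lower w)) ⟩
      deg (complement G) w + suc (deg G w)    ≡⟨ deg-complement G w ⟩
      n                                       ≡⟨ order ⟩
      suc x + σ + suc (suc y)                 ≡⟨ swap x σ y ⟩
      suc y + σ + suc (suc x)                 ∎)
  }
  where
  open DegreeWindow W
  open ≤-Reasoning
  swap : ∀ x σ y → suc x + σ + suc (suc y) ≡ suc y + σ + suc (suc x)
  swap = solve-∀
  swap′ : ∀ x σ y → suc y + suc (suc x + σ) ≡ suc x + σ + suc (suc y)
  swap′ = solve-∀

sparse-deletion : ∀ {n} {H : Graph n} {x σ y} → DegreeWindow H x σ y →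
  (suc x + σ) * suc (suc x + σ) < suc x * suc y → ∀ {u v} → Edge H u v → Switchable H u v
sparse-deletion {H = H} {x} {σ} {y} W sparse {u} {v} uv =
  let z , w , uz , vw , zw = edge-between H lower upper (adj C u) (adj C v) few-non-neighbours
  in inj₁ (w , z , record
    { e₀₁   = uv
    ; e₁₂   = Edge-complement⁻ H vw
    ; e₂₃   = Edge-sym H zw
    ; e₃₀   = Edge-complement⁻ H (Edge-sym C uz)
    ; p₁≢p₂ = Edge⇒≢ C vw
    ; p₃≢p₀ = Edge⇒≢ C uz ∘ sym
    })
  where
  open DegreeWindow W
  open ≤-Reasoning
  C = complement H
  few-non-neighbours : (suc x + σ) * count (not ∘ adj C v) < suc x * count (adj C u)
  few-non-neighbours = begin-strict
    (suc x + σ) * count (not ∘ adj C v)   ≡⟨ cong ((suc x + σ) *_) (count-non-neighbours H v) ⟩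
    (suc x + σ) * suc (deg H v)           ≤⟨ *-monoʳ-≤ (suc x + σ) (s≤s (upper v)) ⟩
    (suc x + σ) * suc (suc x + σ)         <⟨ sparse ⟩
    suc x * suc y                         ≤⟨ *-monoʳ-≤ (suc x) (DegreeWindow.lower (complement-window W) u) ⟩
    suc x * deg C u                       ≡⟨ cong (suc x *_) (deg≡count C u) ⟩
    suc x * count (adj C u)               ∎

module _ {n} {H : Graph n} {x σ y} (W : DegreeWindow H x σ y) (dense : n * (σ + 2) < suc y * x)
         {u v} (uv : Edge H u v) where

  private
    open DegreeWindow W
    C = complement H

    Square : Set
    Square = ∃₂ λ a d → Edge C v a × Edge C u d × Edge H a d

    Hexagon : Set
    Hexagon = ∃₂ λ b c → b ≢ u × c ≢ v × Edge C b c
              × (∃ λ a → Edge C v a × Edge H a b) × (∃ λ d → Edge C u d × Edge H c d)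

    square? : Dec Square
    square? = any? λ a → any? λ d → (adj C v a ≟ᴮ true) ×-dec (adj C u d ≟ᴮ true) ×-dec (adj H a d ≟ᴮ true)

    hexagon? : Dec Hexagon
    hexagon? = any? λ b → any? λ c → ¬? (b ≟ u) ×-dec ¬? (c ≟ v) ×-dec (adj C b c ≟ᴮ true)
      ×-dec any? (λ a → (adj C v a ≟ᴮ true) ×-dec (adj H a b ≟ᴮ true))
      ×-dec any? (λ d → (adj C u d ≟ᴮ true) ×-dec (adj H c d ≟ᴮ true))

    -- Without squares or hexagons, every b ≠ u has at most σ + 2 neighbours outside N[v], while
    -- every vertex outside N[v] has at least x neighbours other than u; counting the pairs
    -- (b, z) both ways contradicts density.
    module NoSwitch (no-square : ¬ Square) (no-hexagon : ¬ Hexagon) where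
      open ≤-Reasoning

      d₀ : Fin n
      d₀ = proj₁ (count-witness (adj C u) (begin-strict
        0                      <⟨ s≤s z≤n ⟩
        suc y                  ≤⟨ DegreeWindow.lower (complement-window W) u ⟩
        deg C u                ≡⟨ deg≡count C u ⟩
        count (adj C u)        ∎))

      ud₀ : Edge C u d₀
      ud₀ = proj₂ (count-witness (adj C u) _)

      common : Fin n → ℕ
      common b = count (λ z → adj C v z ∧ adj H b z)

      common-bound : ∀ b → b ≢ u → common b ≤ σ + 2
      common-bound b b≢u with any? (λ a → (adj C v a ≟ᴮ true) ×-dec (adj H a b ≟ᴮ true))
      ... | no no-a =
        ≤-trans (sum-mono-≤ (λ z → ≤-reflexive (cong b2n (none z)))) (≤-trans (≤-reflexive (sum-replicate-zero n)) z≤n)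
        where
        none : ∀ z → (adj C v z ∧ adj H b z) ≡ false
        none z = ¬-not (λ vz∧bz → let vz , bz = ∧-≡true vz∧bz in no-a (z , vz , Edge-sym H bz))
      ... | yes (a , va , ab) = +-cancelʳ-≤ (suc x) (common b) (σ + 2) (begin
        common b + suc x                        ≤⟨ +-monoʳ-≤ (common b) (lower d₀) ⟩
        common b + deg H d₀                     ≤⟨ +-monoʳ-≤ (common b) d₀-neighbours ⟩
        common b + (count Q + 2)                ≡⟨ +-assoc (common b) (count Q) 2 ⟨
        common b + count Q + 2                  ≤⟨ +-monoˡ-≤ 2 (count-disjoint-⊆ _ Q (adj H b) (λ _ → proj₂ ∘ ∧-≡true) Q⊆N[b] disjoint) ⟩
        count (adj H b) + 2                     ≡⟨ cong (_+ 2) (deg≡count H b) ⟨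
        deg H b + 2                             ≤⟨ +-monoˡ-≤ 2 (upper b) ⟩
        suc x + σ + 2                           ≡⟨ trans (+-assoc (suc x) σ 2) (+-comm (suc x) (σ + 2)) ⟩
        σ + 2 + suc x                           ∎)
        where
        Q : Fin n → Bool
        Q z = not (z ≡ᵇ b) ∧ (not (z ≡ᵇ v) ∧ adj H d₀ z)
        d₀-neighbours : deg H d₀ ≤ count Q + 2
        d₀-neighbours = begin
          deg H d₀                                          ≡⟨ deg≡count H d₀ ⟩
          count (adj H d₀)                                  ≤⟨ count-remove (adj H d₀) v ⟩
          count (λ z → not (z ≡ᵇ v) ∧ adj H d₀ z) + 1       ≤⟨ +-monoˡ-≤ 1 (count-remove (λ z → not (z ≡ᵇ v) ∧ adj H d₀ z) b) ⟩
          count Q + 1 + 1                                   ≡⟨ +-assoc (count Q) 1 1 ⟩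
          count Q + 2                                       ∎
        Q⊆N[b] : ∀ z → Q z ≡ true → Edge H b z
        Q⊆N[b] z Qz with ∧-≡true Qz | adj H b z in bz
        ... | _ | true = refl
        ... | z≢b , rest | false with ∧-≡true rest
        ...   | z≢v , d₀z = ⊥-elim (no-hexagon (b , z , b≢u , not-≡ᵇ⇒≢ z≢v ,
                  Edge-complement H (not-≡ᵇ⇒≢ z≢b ∘ sym) bz , (a , va , ab) , (d₀ , ud₀ , Edge-sym H d₀z)))
        disjoint : ∀ z → (adj C v z ∧ adj H b z) ≡ true → Q z ≡ true → ⊥
        disjoint z vz∧bz Qz =
          let _ , rest = ∧-≡true {not (z ≡ᵇ b)} Qz
              _ , d₀z = ∧-≡true {not (z ≡ᵇ v)} rest
          in no-square (z , d₀ , proj₁ (∧-≡true vz∧bz) , ud₀ , Edge-sym H d₀z)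

      pairs : Fin n → Fin n → ℕ
      pairs b z = b2n (adj C v z ∧ (not (b ≡ᵇ u) ∧ adj H b z))

      row-bound : ∀ b → ∑[ z < n ] pairs b z ≤ σ + 2
      row-bound b = by-cases (b ≟ u)
        where
        by-cases : Dec (b ≡ u) → ∑[ z < n ] pairs b z ≤ σ + 2
        by-cases (yes refl) = ≤-trans (≤-reflexive (trans (sum-cong-≗ λ z →
            cong b2n (trans (cong (λ e → adj C v z ∧ (not e ∧ adj H b z)) (≡ᵇ-refl b)) (∧-zeroʳ (adj C v z))))
          (sum-replicate-zero n))) z≤n
        by-cases (no b≢u) = ≤-trans (≤-reflexive (sum-cong-≗ λ z →
            cong (λ e → b2n (adj C v z ∧ (not e ∧ adj H b z))) (≢⇒≡ᵇ-false b≢u)))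
          (common-bound b b≢u)

      column-bound : ∀ z → b2n (adj C v z) * x ≤ ∑[ b < n ] pairs b z
      column-bound z = begin
        b2n (adj C v z) * x                                              ≤⟨ *-monoʳ-≤ (b2n (adj C v z)) others ⟩
        b2n (adj C v z) * count (λ b → not (b ≡ᵇ u) ∧ adj H b z)
          ≡⟨ *-distribˡ-sum (b2n (adj C v z)) (λ b → b2n (not (b ≡ᵇ u) ∧ adj H b z)) ⟩
        ∑[ b < n ] (b2n (adj C v z) * b2n (not (b ≡ᵇ u) ∧ adj H b z))
          ≡⟨ sum-cong-≗ (λ b → b2n-∧ (adj C v z) (not (b ≡ᵇ u) ∧ adj H b z)) ⟨
        ∑[ b < n ] pairs b z                                             ∎
        where
        others : x ≤ count (λ b → not (b ≡ᵇ u) ∧ adj H b z)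
        others = +-cancelʳ-≤ 1 x (count (λ b → not (b ≡ᵇ u) ∧ adj H b z)) (begin
          x + 1                                           ≡⟨ +-comm x 1 ⟩
          suc x                                           ≤⟨ lower z ⟩
          deg H z                                         ≡⟨ deg≡count H z ⟩
          count (adj H z)                                 ≡⟨ sum-cong-≗ (λ b → cong b2n (adj-sym H z b)) ⟩
          count (λ b → adj H b z)                         ≤⟨ count-remove (λ b → adj H b z) u ⟩
          count (λ b → not (b ≡ᵇ u) ∧ adj H b z) + 1      ∎)

      impossible : ⊥
      impossible = <⇒≱ dense (begin
        suc y * x                            ≤⟨ *-monoˡ-≤ x (DegreeWindow.lower (complement-window W) v) ⟩
        deg C v * x                          ≡⟨ cong (_* x) (deg≡count C v) ⟩
        count (adj C v) * x                  ≡⟨ *-distribʳ-sum x (b2n ∘ adj C v) ⟩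
        ∑[ z < n ] (b2n (adj C v z) * x)     ≤⟨ sum-mono-≤ column-bound ⟩
        ∑[ z < n ] ∑[ b < n ] pairs b z      ≡⟨ ∑-comm pairs ⟨
        ∑[ b < n ] ∑[ z < n ] pairs b z      ≤⟨ sum-mono-≤ row-bound ⟩
        ∑[ b < n ] (σ + 2)                   ≡⟨ sum-const n (σ + 2) ⟩
        n * (σ + 2)                          ∎)

  dense-deletion : Switchable H u v
  dense-deletion with square? | hexagon?
  ... | yes (a , d , va , ud , ad) | _ = inj₁ (a , d , record
    { e₀₁   = uv
    ; e₁₂   = Edge-complement⁻ H va
    ; e₂₃   = ad
    ; e₃₀   = Edge-complement⁻ H (Edge-sym C ud)
    ; p₁≢p₂ = Edge⇒≢ C va
    ; p₃≢p₀ = Edge⇒≢ C ud ∘ sym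
    })
  ... | no _ | yes (b , c , b≢u , c≢v , bc , (a , va , ab) , (d , ud , cd)) = inj₂ (a , b , c , d , record
    { e₀₁   = uv
    ; e₁₂   = Edge-complement⁻ H va
    ; e₂₃   = ab
    ; e₃₄   = Edge-complement⁻ H bc
    ; e₄₅   = cd
    ; e₅₀   = Edge-complement⁻ H (Edge-sym C ud)
    ; p₁≢p₂ = Edge⇒≢ C va
    ; p₃≢p₄ = Edge⇒≢ C bc
    ; p₅≢p₀ = Edge⇒≢ C ud ∘ sym
    ; p₀≢p₃ = b≢u ∘ sym
    ; p₁≢p₄ = c≢v ∘ sym
    })
  ... | no no-square | no no-hexagon = ⊥-elim (NoSwitch.impossible no-square no-hexagon)

-- With neighbours x′ of u and y′ of v, any edge zw outside N[x′] ∪ N[y′] ∪ {u, v} closes the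
-- alternating hexagon z w x′ u v y′.
sparse-insertion : ∀ {n} {H : Graph n} {x σ y} → DegreeWindow H x σ y →
  (suc x + σ) * (2 * (suc x + σ) + 4) < suc x * (n ∸ (2 * (suc x + σ) + 4)) →
  ∀ {u v} → u ≢ v → NonEdge H u v → Insertion H u v
sparse-insertion {n} {H} {x} {σ} W sparse {u} {v} u≢v uv =
  let z , w , okz , okw , zw = edge-between H lower upper OK OK few-bad
      _ , y′z , _ , z≢y′ , z≢u , _ = avoids okz
      x′w , _ , w≢x′ , _ , _ , w≢v = avoids okw
  in hexagon-insertion {p₀ = z} {w} {x′} {u} {v} {y′} (record
    { e₀₁   = zw
    ; e₁₂   = NonEdge-sym H x′w
    ; e₂₃   = Edge-sym H ux′
    ; e₃₄   = uv
    ; e₄₅   = vy′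
    ; e₅₀   = y′z
    ; p₁≢p₂ = w≢x′
    ; p₃≢p₄ = u≢v
    ; p₅≢p₀ = z≢y′ ∘ sym
    ; p₀≢p₃ = z≢u
    ; p₁≢p₄ = w≢v
    })
  where
  open DegreeWindow W
  open ≤-Reasoning
  Δ = suc x + σ
  x′ = proj₁ (has-neighbour H u (≤-trans (s≤s z≤n) (lower u)))
  ux′ = proj₂ (has-neighbour H u (≤-trans (s≤s z≤n) (lower u)))
  y′ = proj₁ (has-neighbour H v (≤-trans (s≤s z≤n) (lower v)))
  vy′ = proj₂ (has-neighbour H v (≤-trans (s≤s z≤n) (lower v)))

  Bad OK : Fin n → Bool
  Bad t = adj H x′ t ∨ adj H y′ t ∨ t ≡ᵇ x′ ∨ t ≡ᵇ y′ ∨ t ≡ᵇ u ∨ t ≡ᵇ v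
  OK = not ∘ Bad

  avoids : ∀ {t} → OK t ≡ true →
    NonEdge H x′ t × NonEdge H y′ t × t ≢ x′ × t ≢ y′ × t ≢ u × t ≢ v
  avoids {t} ok =
    let x′t , r₁ = ∨-≡false (trans (sym (not-involutive (Bad t))) (cong not ok))
        y′t , r₂ = ∨-≡false r₁
        t≠x′ , r₃ = ∨-≡false r₂
        t≠y′ , r₄ = ∨-≡false r₃
        t≠u , t≠v = ∨-≡false r₄
    in x′t , y′t , ≡ᵇ-false⇒≢ t≠x′ , ≡ᵇ-false⇒≢ t≠y′ , ≡ᵇ-false⇒≢ t≠u , ≡ᵇ-false⇒≢ t≠v

  count-Bad : count (not ∘ OK) ≤ 2 * Δ + 4
  count-Bad = begin
    count (not ∘ OK)
      ≡⟨ sum-cong-≗ (λ t → cong b2n (not-involutive (Bad t))) ⟩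
    count Bad
      ≤⟨ ≤-trans (count-∨ (adj H x′) _) (+-monoʳ-≤ (count (adj H x′)) (≤-trans (count-∨ (adj H y′) _)
         (+-monoʳ-≤ (count (adj H y′)) (≤-trans (count-∨ (_≡ᵇ x′) _) (+-monoʳ-≤ (count (_≡ᵇ x′))
         (≤-trans (count-∨ (_≡ᵇ y′) _) (+-monoʳ-≤ (count (_≡ᵇ y′)) (count-∨ (_≡ᵇ u) (_≡ᵇ v))))))))) ⟩
    count (adj H x′) + (count (adj H y′) + (count (_≡ᵇ x′) + (count (_≡ᵇ y′) + (count (_≡ᵇ u) + count (_≡ᵇ v)))))
      ≡⟨ cong₂ _+_ (sym (deg≡count H x′)) (cong₂ _+_ (sym (deg≡count H y′))
           (cong₂ _+_ (count-≡ᵇ x′) (cong₂ _+_ (count-≡ᵇ y′) (cong₂ _+_ (count-≡ᵇ u) (count-≡ᵇ v))))) ⟩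
    deg H x′ + (deg H y′ + 4)
      ≤⟨ +-mono-≤ (upper x′) (+-monoˡ-≤ 4 (upper y′)) ⟩
    Δ + (Δ + 4)
      ≡⟨ double Δ ⟩
    2 * Δ + 4 ∎
    where
    double : ∀ Δ → Δ + (Δ + 4) ≡ 2 * Δ + 4
    double = solve-∀

  count-OK : n ∸ (2 * Δ + 4) ≤ count OK
  count-OK = begin
    n ∸ (2 * Δ + 4)                                   ≤⟨ ∸-monoʳ-≤ n count-Bad ⟩
    n ∸ count (not ∘ OK)                              ≡⟨ cong (_∸ count (not ∘ OK)) (count-not OK) ⟨
    count (not ∘ OK) + count OK ∸ count (not ∘ OK)    ≡⟨ m+n∸m≡n (count (not ∘ OK)) (count OK) ⟩
    count OK                                          ∎

  few-bad : Δ * count (not ∘ OK) < suc x * count OK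
  few-bad = begin-strict
    Δ * count (not ∘ OK)          ≤⟨ *-monoʳ-≤ Δ count-Bad ⟩
    Δ * (2 * Δ + 4)               <⟨ sparse ⟩
    suc x * (n ∸ (2 * Δ + 4))     ≤⟨ *-monoʳ-≤ (suc x) count-OK ⟩
    suc x * count OK              ∎

record Flexible {n} (G : Graph n) : Set where
  field
    delete : ∀ {u v} → Edge G u v → Deletion G u v
    insert : ∀ {u v} → u ≢ v → NonEdge G u v → Insertion G u v

dense-flexible : ∀ {n} {G : Graph n} {x σ y} → DegreeWindow G x σ y → n * (σ + 2) < x * y → Flexible G
dense-flexible {G = G} {x} {σ} {y} W dense = record
  { delete = λ uv → Switchable⇒Deletion (dense-deletion W (<-≤-trans dense xy≤) uv)
  ; insert = λ u≢v uv → complement-Switchable⇒Insertion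
      (dense-deletion (complement-window W) (<-≤-trans dense yx≤) (Edge-complement G u≢v uv))
  }
  where
  xy≤ : x * y ≤ suc y * x
  xy≤ = ≤-trans (≤-reflexive (*-comm x y)) (*-monoˡ-≤ x (n≤1+n y))
  yx≤ : x * y ≤ suc x * y
  yx≤ = *-monoˡ-≤ y (n≤1+n x)

sparse-flexible : ∀ {n} {G : Graph n} {x σ y} → DegreeWindow G x σ y →
  (suc x + σ) * suc (suc x + σ) < suc x * suc y →
  (suc x + σ) * (2 * (suc x + σ) + 4) < suc x * (n ∸ (2 * (suc x + σ) + 4)) → Flexible G
sparse-flexible W sparse₁ sparse₂ = record
  { delete = λ uv → Switchable⇒Deletion (sparse-deletion W sparse₁ uv)
  ; insert = sparse-insertion W sparse₂
  }

-- Arithmetic of the two regimes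

sqrt-below : ℕ → ℕ → ℕ
sqrt-below r zero = zero
sqrt-below r (suc k) with suc k * suc k ≤? r
... | yes _ = suc k
... | no  _ = sqrt-below r k

sqrt-below-sound : ∀ r k → sqrt-below r k * sqrt-below r k ≤ r
sqrt-below-sound r zero = z≤n
sqrt-below-sound r (suc k) with suc k * suc k ≤? r
... | yes k²≤r = k²≤r
... | no  _    = sqrt-below-sound r k

sqrt-below-maximal : ∀ r k {t} → t ≤ k → t * t ≤ r → t ≤ sqrt-below r k
sqrt-below-maximal r zero    t≤k _ = t≤k
sqrt-below-maximal r (suc k) t≤k t²≤r with suc k * suc k ≤? r | m≤n⇒m<n∨m≡n t≤k
... | yes _  | _               = t≤k
... | no  _  | inj₁ (s≤s t≤k′) = sqrt-below-maximal r k t≤k′ t²≤r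
... | no  k² | inj₂ refl       = contradiction t²≤r k²

⌊√_⌋ : ℕ → ℕ
⌊√ r ⌋ = sqrt-below r r

⌊√⌋²≤ : ∀ r → ⌊√ r ⌋ * ⌊√ r ⌋ ≤ r
⌊√⌋²≤ r = sqrt-below-sound r r

≤⌊√⌋ : ∀ {r t} → t * t ≤ r → t ≤ ⌊√ r ⌋
≤⌊√⌋ {r} {zero}  _    = z≤n
≤⌊√⌋ {r} {suc t} t²≤r = sqrt-below-maximal r r (≤-trans (m≤m*n (suc t) (suc t)) t²≤r) t²≤r

^-bound⇒²-bound : ∀ {p q r t} → 0 < p → 2 * p < q → t ^ q ≤ r ^ p → t * t ≤ r
^-bound⇒²-bound {p} {q} {r} {t} 0<p 2p<q tᵠ≤rᵖ with t * t ≤? r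
... | yes t²≤r = t²≤r
... | no  t²≰r = contradiction tᵠ≤rᵖ (<⇒≱ (begin-strict
  r ^ p            <⟨ ^-monoˡ-< p {{>-nonZero 0<p}} (≰⇒> t²≰r) ⟩
  (t * t) ^ p      ≡⟨ cong (λ t² → (t * t²) ^ p) (*-identityʳ t) ⟨
  (t ^ 2) ^ p      ≡⟨ ^-*-assoc t 2 p ⟩
  t ^ (2 * p)      ≤⟨ ^-monoʳ-≤ t {{t≢0}} (<⇒≤ 2p<q) ⟩
  t ^ q            ∎))
  where
  open ≤-Reasoning
  t≢0 : NonZero t
  t≢0 = ≢-nonZero (λ { refl → t²≰r z≤n })

²≤⇒< : ∀ {s r} → s * s ≤ r → 2 ≤ r → s < r
²≤⇒< {s} {r} s²≤r 2≤r with s <? r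
... | yes s<r = s<r
... | no  s≮r = contradiction (begin-strict
  r          <⟨ m<m+n r (≤-trans (s≤s z≤n) 2≤r) ⟩
  r + r      ≡⟨ cong (r +_) (+-identityʳ r) ⟨
  2 * r      ≤⟨ *-monoˡ-≤ r 2≤r ⟩
  r * r      ≤⟨ *-mono-≤ (≮⇒≥ s≮r) (≮⇒≥ s≮r) ⟩
  s * s      ≤⟨ s²≤r ⟩
  r          ∎) (<-irrefl refl)
  where open ≤-Reasoning

dense-product : ∀ s x y → 8 * suc s ≤ x → 8 * suc s ≤ y → (suc x + (s + s) + suc (suc y)) * (s + s + 2) < x * y
dense-product s x y x-large y-large = begin-strict
  (suc x + (s + s) + suc (suc y)) * (s + s + 2)          ≡⟨ regroup s x y ⟩
  (x + y) * (2 * suc s) + (2 * suc s + 1) * (2 * suc s)  <⟨ +-monoʳ-< ((x + y) * (2 * suc s)) (*-monoˡ-< (2 * suc s) short) ⟩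
  (x + y) * (2 * suc s) + (x + y) * (2 * suc s)          ≡⟨ quadruple s x y ⟩
  x * (4 * suc s) + (4 * suc s) * y                      ≤⟨ *-cancelˡ-≤ 2 (begin
      2 * (x * (4 * suc s) + (4 * suc s) * y)  ≡⟨ double s x y ⟩
      x * (8 * suc s) + (8 * suc s) * y        ≤⟨ +-mono-≤ (*-monoʳ-≤ x y-large) (*-monoˡ-≤ y x-large) ⟩
      x * y + x * y                            ≡⟨ cong (x * y +_) (+-identityʳ (x * y)) ⟨
      2 * (x * y)                              ∎) ⟩
  x * y                                                  ∎
  where
  open ≤-Reasoning
  regroup : ∀ s x y → (suc x + (s + s) + suc (suc y)) * (s + s + 2) ≡ (x + y) * (2 * suc s) + (2 * suc s + 1) * (2 * suc s)
  regroup = solve-∀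
  quadruple : ∀ s x y → (x + y) * (2 * suc s) + (x + y) * (2 * suc s) ≡ x * (4 * suc s) + (4 * suc s) * y
  quadruple = solve-∀
  double : ∀ s x y → 2 * (x * (4 * suc s) + (4 * suc s) * y) ≡ x * (8 * suc s) + (8 * suc s) * y
  double = solve-∀
  sixteen : ∀ s → suc (2 * suc s + 1) + (14 * s + 12) ≡ 8 * suc s + 8 * suc s
  sixteen = solve-∀
  short : 2 * suc s + 1 < x + y
  short = begin-strict
    2 * suc s + 1                        <⟨ m≤m+n (suc (2 * suc s + 1)) (14 * s + 12) ⟩
    suc (2 * suc s + 1) + (14 * s + 12)  ≡⟨ sixteen s ⟩
    8 * suc s + 8 * suc s                ≤⟨ +-mono-≤ x-large y-large ⟩
    x + y                                ∎

-- Since r ≤ (1 − a/b) n, the gap n − r is at least r / b.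
dense-gap : ∀ {a b n r s} → 0 < a → a < b → b * r ≤ (b ∸ a) * n → 11 * b * suc s ≤ r → r + 11 * suc s ≤ n
dense-gap {a} {b} {n} {r} {s} 0<a a<b br≤ large = begin
  r + 11 * suc s          ≤⟨ +-monoʳ-≤ r (*-cancelˡ-≤ b gap) ⟩
  r + (n ∸ r)             ≡⟨ m+[n∸m]≡n r≤n ⟩
  n                       ∎
  where
  open ≤-Reasoning
  instance
    b≢0 : NonZero b
    b≢0 = >-nonZero (≤-trans (s≤s z≤n) a<b)
  r≤n : r ≤ n
  r≤n = *-cancelˡ-≤ b (≤-trans br≤ (*-monoˡ-≤ n (m∸n≤m b a)))
  gap : b * (11 * suc s) ≤ b * (n ∸ r)
  gap = begin
    b * (11 * suc s)          ≡⟨ reassociate b s ⟩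
    11 * b * suc s            ≤⟨ large ⟩
    r                         ≤⟨ r≤n ⟩
    n                         ≤⟨ m≤n*m n a {{>-nonZero 0<a}} ⟩
    a * n                     ≡⟨ cong (_* n) (m∸[m∸n]≡n (<⇒≤ a<b)) ⟨
    (b ∸ (b ∸ a)) * n         ≡⟨ *-distribʳ-∸ n b (b ∸ a) ⟩
    b * n ∸ (b ∸ a) * n       ≤⟨ ∸-monoʳ-≤ (b * n) br≤ ⟩
    b * n ∸ b * r             ≡⟨ *-distribˡ-∸ b n r ⟨
    b * (n ∸ r)               ∎
    where
    reassociate : ∀ b s → b * (11 * suc s) ≡ 11 * b * suc s
    reassociate = solve-∀

dense-regime : ∀ {a b n r s} → 0 < a → a < b → b * r ≤ (b ∸ a) * n → 11 * b * suc s ≤ r →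
  ∃₂ λ x y → r ≡ suc x + s × n ≡ suc x + (s + s) + suc (suc y) × n * (s + s + 2) < x * y
dense-regime {a} {b} {n} {r} {s} 0<a a<b br≤ large =
  let j , r≡ = m≤n⇒∃[o]m+o≡n r-large
      k , n≡ = m≤n⇒∃[o]m+o≡n (dense-gap {s = s} 0<a a<b br≤ large)
  in sizes j k r≡ n≡
  where
  r-large : 11 * suc s ≤ r
  r-large = ≤-trans (*-monoˡ-≤ (suc s) (m≤m*n 11 b {{>-nonZero (≤-trans (s≤s z≤n) a<b)}})) large
  sizes : ∀ j k → 11 * suc s + j ≡ r → r + 11 * suc s + k ≡ n →
    ∃₂ λ x y → r ≡ suc x + s × n ≡ suc x + (s + s) + suc (suc y) × n * (s + s + 2) < x * y
  sizes j k r≡ n≡ = x , y , r-shape , n-shape , subst (λ m → m * (s + s + 2) < x * y) (sym n-shape)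
    (dense-product s x y (≤-trans (m≤m+n (8 * suc s) (2 * suc s + j)) (≤-reflexive (x-split s j)))
                         (≤-trans (m≤m+n (8 * suc s) (1 + 2 * s + k)) (≤-reflexive (y-split s k))))
    where
    x = 10 * suc s + j
    y = 9 + 10 * s + k
    r-shape : r ≡ suc x + s
    r-shape = trans (sym r≡) (shape s j)
      where shape : ∀ s j → 11 * suc s + j ≡ suc (10 * suc s + j) + s
            shape = solve-∀
    n-shape : n ≡ suc x + (s + s) + suc (suc y)
    n-shape = trans (sym n≡) (trans (cong (λ m → m + 11 * suc s + k) (sym r≡)) (shape s j k))
      where shape : ∀ s j k → 11 * suc s + j + 11 * suc s + k ≡ suc (10 * suc s + j) + (s + s) + suc (suc (9 + 10 * s + k))
            shape = solve-∀
    x-split : ∀ s j → 8 * suc s + (2 * suc s + j) ≡ 10 * suc s + j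
    x-split = solve-∀
    y-split : ∀ s k → 8 * suc s + (1 + 2 * s + k) ≡ 9 + 10 * s + k
    y-split = solve-∀

sparse-product : ∀ {Δ B n y} δ → Δ ≤ B → (B + 1) * (2 * B + 4) < n → n ≡ Δ + suc (suc y) →
  Δ * suc Δ < suc δ * suc y × Δ * (2 * Δ + 4) < suc δ * (n ∸ (2 * Δ + 4))
sparse-product {Δ} {B} {n} {y} δ Δ≤B large n≡ = few-neighbours , few-excluded
  where
  open ≤-Reasoning
  Δ-large : (Δ + 1) * (2 * Δ + 4) < n
  Δ-large = ≤-<-trans (*-mono-≤ (+-monoˡ-≤ 1 Δ≤B) (+-monoˡ-≤ 4 (*-monoʳ-≤ 2 Δ≤B))) large
  split₁ : ∀ Δ → (Δ + 1) * (2 * Δ + 4) ≡ suc (Δ * suc Δ) + suc Δ + (Δ * Δ + 4 * Δ + 2)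
  split₁ = solve-∀
  split₂ : ∀ Δ → (Δ + 1) * (2 * Δ + 4) ≡ Δ * (2 * Δ + 4) + (2 * Δ + 4)
  split₂ = solve-∀
  few-neighbours : Δ * suc Δ < suc δ * suc y
  few-neighbours = ≤-trans (+-cancelʳ-≤ (suc Δ) (suc (Δ * suc Δ)) (suc y) (begin
      suc (Δ * suc Δ) + suc Δ                                    ≤⟨ m≤m+n _ (Δ * Δ + 4 * Δ + 2) ⟩
      suc (Δ * suc Δ) + suc Δ + (Δ * Δ + 4 * Δ + 2)              ≡⟨ split₁ Δ ⟨
      (Δ + 1) * (2 * Δ + 4)                                      ≤⟨ <⇒≤ Δ-large ⟩
      n                                                          ≡⟨ trans n≡ (+-comm Δ (suc (suc y))) ⟩
      suc (suc y) + Δ                                            ≡⟨ +-suc (suc y) Δ ⟨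
      suc y + suc Δ                                              ∎))
    (m≤n*m (suc y) (suc δ))
  few-excluded : Δ * (2 * Δ + 4) < suc δ * (n ∸ (2 * Δ + 4))
  few-excluded = ≤-trans (m+n≤o⇒m≤o∸n (suc (Δ * (2 * Δ + 4))) (≤-trans (≤-reflexive (cong suc (sym (split₂ Δ)))) Δ-large))
                         (m≤n*m (n ∸ (2 * Δ + 4)) (suc δ))

sparse-degree-bound : ℕ → ℕ
sparse-degree-bound b = 11 * b * (11 * b + 2)

sparse-threshold : ℕ → ℕ
sparse-threshold b = (sparse-degree-bound b + 1) * (2 * sparse-degree-bound b + 4)

-- Below the dense regime, s² ≤ r < 11 b (s + 1) bounds s by 11 b and hence r + s by a constant.
sparse-deviation : ∀ {K r s} → s * s ≤ r → r < K * suc s → r + s ≤ K * (K + 2)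
sparse-deviation {K} {r} {s} s²≤r r<Ks with s ≤? K
... | yes s≤K = begin
  r + s                ≤⟨ +-mono-≤ (<⇒≤ r<Ks) s≤K ⟩
  K * suc s + K        ≤⟨ +-monoˡ-≤ K (*-monoʳ-≤ K (s≤s s≤K)) ⟩
  K * suc K + K        ≡⟨ regroup K ⟩
  K * (K + 2)          ∎
  where
  open ≤-Reasoning
  regroup : ∀ K → K * suc K + K ≡ K * (K + 2)
  regroup = solve-∀
... | no  s≰K = contradiction s²≤r (<⇒≱ (begin-strict
  r                    <⟨ r<Ks ⟩
  K * suc s            ≡⟨ *-suc K s ⟩
  K + K * s            <⟨ +-monoˡ-< (K * s) (≰⇒> s≰K) ⟩
  suc K * s            ≤⟨ *-monoˡ-≤ s (≰⇒> s≰K) ⟩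
  s * s                ∎))
  where open ≤-Reasoning

sparse-regime : ∀ {b n r s} → s * s ≤ r → 2 ≤ r → r < 11 * b * suc s → sparse-threshold b < n →
  ∃₂ λ x y → r ≡ suc x + s × n ≡ suc x + (s + s) + suc (suc y)
    × (suc x + (s + s)) * suc (suc x + (s + s)) < suc x * suc y
    × (suc x + (s + s)) * (2 * (suc x + (s + s)) + 4) < suc x * (n ∸ (2 * (suc x + (s + s)) + 4))
sparse-regime {b} {n} {r} {s} s²≤r 2≤r small large =
  let j , r≡ = m≤n⇒∃[o]m+o≡n (²≤⇒< s²≤r 2≤r)
      k , n≡ = m≤n⇒∃[o]m+o≡n n-large
  in sizes j k r≡ n≡
  where
  open ≤-Reasoning
  B = sparse-degree-bound b
  Δ≤B : r + s ≤ B
  Δ≤B = sparse-deviation {K = 11 * b} s²≤r small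
  n-large : r + s + 2 ≤ n
  n-large = begin
    r + s + 2                               ≤⟨ +-monoˡ-≤ 2 Δ≤B ⟩
    B + 2                                   ≤⟨ m≤m+n (B + 2) (2 * B * B + 5 * B + 2) ⟩
    B + 2 + (2 * B * B + 5 * B + 2)         ≡⟨ expand B ⟩
    sparse-threshold b                      ≤⟨ <⇒≤ large ⟩
    n                                       ∎
    where
    expand : ∀ B → B + 2 + (2 * B * B + 5 * B + 2) ≡ (B + 1) * (2 * B + 4)
    expand = solve-∀
  sizes : ∀ j k → suc s + j ≡ r → r + s + 2 + k ≡ n →
    ∃₂ λ x y → r ≡ suc x + s × n ≡ suc x + (s + s) + suc (suc y)
      × (suc x + (s + s)) * suc (suc x + (s + s)) < suc x * suc y
      × (suc x + (s + s)) * (2 * (suc x + (s + s)) + 4) < suc x * (n ∸ (2 * (suc x + (s + s)) + 4))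
  sizes j k r≡ n≡ = j , k , r-shape , n-shape ,
    sparse-product j (≤-trans (≤-reflexive Δ-shape) Δ≤B) large n-shape
    where
    r-shape : r ≡ suc j + s
    r-shape = trans (sym r≡) (cong suc (+-comm s j))
    Δ-shape : suc j + (s + s) ≡ r + s
    Δ-shape = trans (sym (+-assoc (suc j) s s)) (cong (_+ s) (sym r-shape))
    n-shape : n ≡ suc j + (s + s) + suc (suc k)
    n-shape = trans (sym n≡) (trans (cong (λ m → m + s + 2 + k) (sym r≡)) (shape s j k))
      where shape : ∀ s j k → suc s + j + s + 2 + k ≡ suc j + (s + s) + suc (suc k)
            shape = solve-∀

-- Near-regular degree sequences

near-regular-degrees : ∀ {p q r n} {d : Vec ℕ n} {G : Graph n} → 0 < p → 2 * p < q → NearRegular p q r d → HasDegSeq G d →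
  (∀ w → r ≤ deg G w + ⌊√ r ⌋) × (∀ w → deg G w ≤ r + ⌊√ r ⌋)
near-regular-degrees {r = r} {d = d} 0<p 2p<q near G∈d = lower , upper
  where
  deviation : ∀ w → ∣ lookup d w - r ∣ ≤ ⌊√ r ⌋
  deviation w = ≤⌊√⌋ (^-bound⇒²-bound 0<p 2p<q (near w))
  lower : ∀ w → _
  lower w = subst (λ k → r ≤ k + ⌊√ r ⌋) (sym (G∈d w))
    (≤-trans (m≤n+∣n-m∣ r (lookup d w)) (+-monoʳ-≤ (lookup d w) (deviation w)))
  upper : ∀ w → _
  upper w = subst (_≤ r + ⌊√ r ⌋) (sym (G∈d w))
    (≤-trans (m≤n+∣m-n∣ (lookup d w) r) (+-monoʳ-≤ r (deviation w)))

near-regular-window : ∀ {n} {G : Graph n} {r s x y} → r ≡ suc x + s → n ≡ suc x + (s + s) + suc (suc y) →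
  (∀ w → r ≤ deg G w + s) → (∀ w → deg G w ≤ r + s) → DegreeWindow G x (s + s) y
near-regular-window {G = G} {r} {s} {x} r≡ n≡ lo hi = record
  { order = n≡
  ; lower = λ w → +-cancelʳ-≤ s (suc x) (deg G w) (subst (λ k → k ≤ deg G w + s) r≡ (lo w))
  ; upper = λ w → ≤-trans (hi w) (≤-reflexive (trans (cong (_+ s) r≡) (+-assoc (suc x) s s)))
  }

near-regular-flexible : ∀ {n} {G : Graph n} {a b r s} → 0 < a → a < b → s * s ≤ r → 2 ≤ r →
  b * r ≤ (b ∸ a) * n → sparse-threshold b < n →
  (∀ w → r ≤ deg G w + s) → (∀ w → deg G w ≤ r + s) → Flexible G
near-regular-flexible {b = b} {r} {s} 0<a a<b s²≤r 2≤r br≤ large lo hi with 11 * b * suc s ≤? r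
... | yes dense  = let _ , _ , r≡ , n≡ , product = dense-regime {b = b} 0<a a<b br≤ dense
                   in dense-flexible (near-regular-window r≡ n≡ lo hi) product
... | no  sparse = let _ , _ , r≡ , n≡ , sparse₁ , sparse₂ = sparse-regime {b = b} s²≤r 2≤r (≰⇒> sparse) large
                   in sparse-flexible (near-regular-window r≡ n≡ lo hi) sparse₁ sparse₂

lemma2p9 : (p q a b : ℕ) → 0 < p → 2 * p < q → 0 < a → a < b →
    Σ ℕ λ n₁ → ∀ (n r : ℕ) → n₁ ≤ n → 2 ≤ r → b * r ≤ (b ∸ a) * n →
      (d : Vec ℕ n) → NearRegular p q r d →
      (G : Graph n) → HasDegSeq G d →
        (∀ (u v : Fin n) → u ≢ v →
          (Edge G u v → Σ (Graph n) λ G' →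
              HasDegSeq G' d × NonEdge G' u v × symDiffSize G G' ≤ 12)
          × (NonEdge G u v → Σ (Graph n) λ G' →
              HasDegSeq G' d × Edge G' u v × symDiffSize G G' ≤ 12))
        × (∀ (u v w : Fin n) → v ≢ w → Edge G u w → Edge G u v →
             Σ (Graph n) λ G' →
               HasDegSeq G' d × Edge G' u w × NonEdge G' u v × symDiffSize G G' ≤ 12)
lemma2p9 p q a b 0<p 2p<q 0<a a<b = suc (sparse-threshold b) , λ n r large 2≤r br≤ d near G G∈d →
  let lo , hi = near-regular-degrees {d = d} {G} 0<p 2p<q near G∈d
      open Flexible (near-regular-flexible {G = G} {b = b} 0<a a<b (⌊√⌋²≤ r) 2≤r br≤ large lo hi)
      degrees : ∀ {G′} → (∀ w → deg G′ w ≡ deg G w) → HasDegSeq G′ d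
      degrees same i = trans (same i) (G∈d i)
  in (λ u v u≢v →
        (λ uv → let open Deletion (delete uv) in graph , degrees {graph} same-degrees , deleted , close)
      , (λ uv → let open Insertion (insert u≢v uv) in graph , degrees {graph} same-degrees , inserted , close))
   , (λ u v w v≢w uw uv → let open Deletion (delete uv) in
        graph , degrees {graph} same-degrees , keeps w (v≢w ∘ sym) uw , deleted , close)
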